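{- Let $C$ be a binary linear code of effective length $n\le 56$ and dimension $k$ all of whose non-zero codewords have weight $24$ or $32$. Then $k\le 8$. Moreover, if $k=8$ then $n\in\{51,54,55,56\}$, and if $(n,k)=(51,8)$ then $C$ is projective.
   Context: A binary linear code is a subspace of $\mathbb{F}_2^n$; codes are considered to be of full length (every coordinate is non-zero in some codeword), $n$ being the effective length. Weight = number of non-zero coordinates. $C$ is projective if the dual code $C^\perp$ has minimum distance at least $3$. -}

module Defs where

open import Data.Bool using (Bool; true; false; _xor_; _∧_; if_then_else_)
open import Data.Nat using (ℕ; zero; suc; _+_; _≤_)
open import Data.Fin using (Fin)
open import Data.Vec using (Vec; []; _∷_; replicate; zipWith; lookup)
open import Data.Product using (∃; _×_)
open import Relation.Binary.PropositionalEquality using (_≡_; _≢_)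

-- The field F₂ is modelled by Bool (addition = xor, multiplication = ∧).
-- Vectors of F₂ⁿ are Vec Bool n.

zeroVec : (n : ℕ) → Vec Bool n
zeroVec n = replicate n false

_⊕_ : {n : ℕ} → Vec Bool n → Vec Bool n → Vec Bool n
u ⊕ v = zipWith _xor_ u v

wt : {n : ℕ} → Vec Bool n → ℕ
wt [] = 0
wt (true ∷ v) = suc (wt v)
wt (false ∷ v) = wt v

dot : {n : ℕ} → Vec Bool n → Vec Bool n → Bool
dot [] [] = false
dot (a ∷ u) (b ∷ v) = (a ∧ b) xor dot u v

-- A binary linear code C ⊆ F₂ⁿ of dimension k is given by a generator
-- matrix G (k rows in F₂ⁿ, forming a basis of C); C is the row space of G.
Generator : ℕ → ℕ → Set
Generator n k = Vec (Vec Bool n) k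

encode : {n k : ℕ} → Generator n k → Vec Bool k → Vec Bool n
encode {n} [] [] = zeroVec n
encode (g ∷ G) (b ∷ m) = if b then g ⊕ encode G m else encode G m

_∈C_ : {n k : ℕ} → Vec Bool n → Generator n k → Set
c ∈C G = ∃ λ m → encode G m ≡ c

LinIndep : {n k : ℕ} → Generator n k → Set
LinIndep {n} {k} G = (m : Vec Bool k) → encode G m ≡ zeroVec n → m ≡ zeroVec k

FullLength : {n k : ℕ} → Generator n k → Set
FullLength {n} G = (j : Fin n) → ∃ λ c → c ∈C G × lookup c j ≡ true

_∈Dual_ : {n k : ℕ} → Vec Bool n → Generator n k → Set
x ∈Dual G = ∀ c → c ∈C G → dot x c ≡ false

Projective : {n k : ℕ} → Generator n k → Set
Projective {n} G = ∀ x → x ∈Dual G → x ≢ zeroVec n → 3 ≤ wt x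

-- Write the n columns of a generator matrix as a multiset in F₂ᵏ, with multiplicity mult v, and let
-- bias m = Σⱼ (−1)^(m·colⱼ) = n − 2 wt(mG). As the nonzero weights are 24 and 32, the polynomial
-- P x = (x − (n − 48)) (x − (n − 64)) vanishes at bias m for m ≠ 0 and equals 3072 at m = 0, so
-- summing (−1)^(m·v) P (bias m) over all m and using orthogonality of characters gives, for every v,
--   2ᵏ (pairs v + (112 − 2n) mult v + (n − 48)(n − 64) [v = 0]) = 3072,
-- where pairs v counts the ordered pairs of columns with sum v. At v = 0 this reads
-- 2ᵏ (n + X + (n − 48)(n − 64)) = 3072 with X = Σⱼ (mult colⱼ − 1) even, so k ≤ 10, and for n ≤ 56
-- only few (n, k, X) survive. Dimension 10 fails by parity. For k = 9 with n ≤ 54, and for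
-- (n, k) = (52, 8), the identity at v ≠ 0 makes all columns distinct, i.e. X = 0, which is not the
-- forced value; for k = 9 with n ≥ 55 it allows only one repeated column, so X = m(m − 1) ≠ 14.
-- For (n, k) = (53, 8) a second-moment count of how the 7 doubled columns translate the 46 column
-- values is contradictory. For (n, k) = (51, 8) we get X = 0: the columns are distinct and nonzero,
-- which is projectivity.

module Submission where

open import Defs
open import Data.Bool using (Bool; true; false; _xor_)
import Data.Bool.Properties as Boolₚ
open import Data.Fin using (Fin; zero; suc; toℕ; fromℕ<)
import Data.Fin.Properties as Finₚ
open import Data.Nat using (ℕ; zero; suc)
open import Data.Product using (∃; _×_; _,_; proj₁; proj₂)
open import Data.Sum using (_⊎_; inj₁; inj₂; [_,_]′)
open import Data.Vec using (Vec; []; _∷_; lookup; map)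
import Data.Vec.Properties as Vecₚ
open import Function using (_∘_)
open import Algebra.Bundles using (CommutativeRing; Semiring)
open import Algebra.Properties.CommutativeSemigroup
  (CommutativeRing.+-commutativeSemigroup Boolₚ.xor-∧-commutativeRing)
  using () renaming (interchange to xor-interchange)
open import Data.Empty using (⊥; ⊥-elim)
open import Relation.Nullary using (¬_; Dec; yes; no; contradiction)
open import Relation.Nullary.Decidable using (True; toWitness; ¬?; _⊎-dec_; _×-dec_; _→-dec_)
open import Relation.Binary.Definitions using (DecidableEquality)
open import Relation.Binary.PropositionalEquality
  using (_≡_; _≢_; refl; sym; trans; cong; cong₂; subst; module ≡-Reasoning)

⊕-comm : ∀ {k} (x y : Vec Bool k) → x ⊕ y ≡ y ⊕ x
⊕-comm = Vecₚ.zipWith-comm Boolₚ.xor-comm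

⊕-assoc : ∀ {k} (x y z : Vec Bool k) → (x ⊕ y) ⊕ z ≡ x ⊕ (y ⊕ z)
⊕-assoc = Vecₚ.zipWith-assoc Boolₚ.xor-assoc

⊕-identityˡ : ∀ {k} (x : Vec Bool k) → zeroVec k ⊕ x ≡ x
⊕-identityˡ = Vecₚ.zipWith-identityˡ Boolₚ.xor-identityˡ

⊕-identityʳ : ∀ {k} (x : Vec Bool k) → x ⊕ zeroVec k ≡ x
⊕-identityʳ = Vecₚ.zipWith-identityʳ Boolₚ.xor-identityʳ

⊕-self : ∀ {k} (x : Vec Bool k) → x ⊕ x ≡ zeroVec k
⊕-self []      = refl
⊕-self (a ∷ x) = cong₂ _∷_ (Boolₚ.xor-same a) (⊕-self x)

⊕-cancelʳ : ∀ {k} (x u : Vec Bool k) → (x ⊕ u) ⊕ u ≡ x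
⊕-cancelʳ {k} x u = begin
  (x ⊕ u) ⊕ u    ≡⟨ ⊕-assoc x u u ⟩
  x ⊕ (u ⊕ u)    ≡⟨ cong (x ⊕_) (⊕-self u) ⟩
  x ⊕ zeroVec k  ≡⟨ ⊕-identityʳ x ⟩
  x              ∎
  where open ≡-Reasoning

⊕-cancelˡ : ∀ {k} (u x : Vec Bool k) → (u ⊕ x) ⊕ u ≡ x
⊕-cancelˡ u x = trans (cong (_⊕ u) (⊕-comm u x)) (⊕-cancelʳ x u)

⊕≡zero⇒≡ : ∀ {k} {x y : Vec Bool k} → x ⊕ y ≡ zeroVec k → x ≡ y
⊕≡zero⇒≡ {x = x} {y} eq = begin
  x               ≡⟨ ⊕-cancelʳ x y ⟨
  (x ⊕ y) ⊕ y     ≡⟨ cong (_⊕ y) eq ⟩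
  zeroVec _ ⊕ y   ≡⟨ ⊕-identityˡ y ⟩
  y               ∎
  where open ≡-Reasoning

_≟ᵛ_ : ∀ {k} → DecidableEquality (Vec Bool k)
_≟ᵛ_ = Vecₚ.≡-dec Data.Bool._≟_

⊕-translate : ∀ {k} (u w z : Vec Bool k) → (u ⊕ w) ⊕ (z ⊕ u) ≡ z ⊕ w
⊕-translate u w z = begin
  (u ⊕ w) ⊕ (z ⊕ u)  ≡⟨ cong ((u ⊕ w) ⊕_) (⊕-comm z u) ⟩
  (u ⊕ w) ⊕ (u ⊕ z)  ≡⟨ ⊕-assoc u w (u ⊕ z) ⟩
  u ⊕ (w ⊕ (u ⊕ z))  ≡⟨ cong (u ⊕_) (⊕-assoc w u z) ⟨
  u ⊕ ((w ⊕ u) ⊕ z)  ≡⟨ cong (λ t → u ⊕ (t ⊕ z)) (⊕-comm w u) ⟩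
  u ⊕ ((u ⊕ w) ⊕ z)  ≡⟨ cong (u ⊕_) (⊕-assoc u w z) ⟩
  u ⊕ (u ⊕ (w ⊕ z))  ≡⟨ ⊕-assoc u u (w ⊕ z) ⟨
  (u ⊕ u) ⊕ (w ⊕ z)  ≡⟨ cong (_⊕ (w ⊕ z)) (⊕-self u) ⟩
  zeroVec _ ⊕ (w ⊕ z) ≡⟨ ⊕-identityˡ (w ⊕ z) ⟩
  w ⊕ z              ≡⟨ ⊕-comm w z ⟩
  z ⊕ w              ∎
  where open ≡-Reasoning

dot-zeroˡ : ∀ {k} (v : Vec Bool k) → dot (zeroVec k) v ≡ false
dot-zeroˡ []      = refl
dot-zeroˡ (a ∷ v) = dot-zeroˡ v

dot-zeroʳ : ∀ {k} (m : Vec Bool k) → dot m (zeroVec k) ≡ false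
dot-zeroʳ []          = refl
dot-zeroʳ (false ∷ m) = dot-zeroʳ m
dot-zeroʳ (true ∷ m)  = dot-zeroʳ m

dot-distribˡ-⊕ : ∀ {k} (m v w : Vec Bool k) → dot m (v ⊕ w) ≡ dot m v xor dot m w
dot-distribˡ-⊕ []          []      []      = refl
dot-distribˡ-⊕ (false ∷ m) (a ∷ v) (b ∷ w) = dot-distribˡ-⊕ m v w
dot-distribˡ-⊕ (true ∷ m)  (a ∷ v) (b ∷ w) = begin
  (a xor b) xor dot m (v ⊕ w)          ≡⟨ cong ((a xor b) xor_) (dot-distribˡ-⊕ m v w) ⟩
  (a xor b) xor (dot m v xor dot m w)  ≡⟨ xor-interchange a b (dot m v) (dot m w) ⟩
  (a xor dot m v) xor (b xor dot m w)  ∎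
  where open ≡-Reasoning

δ₀ : ∀ {k} → Vec Bool k → ℕ
δ₀ []          = 1
δ₀ (true ∷ v)  = 0
δ₀ (false ∷ v) = δ₀ v

δ₀-zero : ∀ k → δ₀ (zeroVec k) ≡ 1
δ₀-zero zero    = refl
δ₀-zero (suc k) = δ₀-zero k

δ₀-nonzero : ∀ {k} {v : Vec Bool k} → v ≢ zeroVec k → δ₀ v ≡ 0
δ₀-nonzero {v = []}        v≢0 = contradiction refl v≢0
δ₀-nonzero {v = true ∷ v}  v≢0 = refl
δ₀-nonzero {v = false ∷ v} v≢0 = δ₀-nonzero (v≢0 ∘ cong (false ∷_))

δ₀-⊕-self : ∀ {k} (u : Vec Bool k) → δ₀ (u ⊕ u) ≡ 1
δ₀-⊕-self {k} u = trans (cong δ₀ (⊕-self u)) (δ₀-zero k)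

δ₀-⊕-≢ : ∀ {k} {u w : Vec Bool k} → u ≢ w → δ₀ (u ⊕ w) ≡ 0
δ₀-⊕-≢ u≢w = δ₀-nonzero (u≢w ∘ ⊕≡zero⇒≡)

col : ∀ {n k} → Generator n k → Fin n → Vec Bool k
col G j = map (λ row → lookup row j) G

lookup-encode : ∀ {n k} (G : Generator n k) (m : Vec Bool k) (j : Fin n) →
                lookup (encode G m) j ≡ dot m (col G j)
lookup-encode []      []          j = Vecₚ.lookup-replicate j false
lookup-encode (g ∷ G) (false ∷ m) j = lookup-encode G m j
lookup-encode (g ∷ G) (true ∷ m)  j = begin
  lookup (g ⊕ encode G m) j                ≡⟨ Vecₚ.lookup-zipWith _xor_ j g (encode G m) ⟩
  lookup g j xor lookup (encode G m) j     ≡⟨ cong (lookup g j xor_) (lookup-encode G m j) ⟩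
  lookup g j xor dot m (col G j)           ∎
  where open ≡-Reasoning

encode-zero : ∀ {n k} (G : Generator n k) → encode G (zeroVec k) ≡ zeroVec n
encode-zero []      = refl
encode-zero (g ∷ G) = encode-zero G

module CubeSum {c ℓ} (R : Semiring c ℓ) where

  open Semiring R
    using (Carrier; _≈_; _+_; _*_; 0#; setoid; +-cong; +-congˡ; +-comm; +-identityˡ; +-identityʳ;
           distribˡ; +-commutativeSemigroup)
    renaming (refl to ≈-refl; sym to ≈-sym; trans to ≈-trans)
  open import Algebra.Properties.Semiring.Sum R using (sum)
  open import Algebra.Properties.CommutativeSemigroup +-commutativeSemigroup using (interchange)
  open import Relation.Binary.Reasoning.Setoid setoid

  ∑ᶜ : ∀ k → (Vec Bool k → Carrier) → Carrier
  ∑ᶜ zero    f = f []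
  ∑ᶜ (suc k) f = ∑ᶜ k (f ∘ (false ∷_)) + ∑ᶜ k (f ∘ (true ∷_))

  ∑ᶜ-cong : ∀ k {f g : Vec Bool k → Carrier} → (∀ m → f m ≈ g m) → ∑ᶜ k f ≈ ∑ᶜ k g
  ∑ᶜ-cong zero    f≈g = f≈g []
  ∑ᶜ-cong (suc k) f≈g = +-cong (∑ᶜ-cong k (f≈g ∘ (false ∷_))) (∑ᶜ-cong k (f≈g ∘ (true ∷_)))

  ∑ᶜ-distrib-+ : ∀ k (f g : Vec Bool k → Carrier) →
                 ∑ᶜ k (λ m → f m + g m) ≈ ∑ᶜ k f + ∑ᶜ k g
  ∑ᶜ-distrib-+ zero    f g = ≈-refl
  ∑ᶜ-distrib-+ (suc k) f g =
    ≈-trans (+-cong (∑ᶜ-distrib-+ k _ _) (∑ᶜ-distrib-+ k _ _)) (interchange _ _ _ _)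

  *-distribˡ-∑ᶜ : ∀ k x (f : Vec Bool k → Carrier) → x * ∑ᶜ k f ≈ ∑ᶜ k (λ m → x * f m)
  *-distribˡ-∑ᶜ zero    x f = ≈-refl
  *-distribˡ-∑ᶜ (suc k) x f =
    ≈-trans (distribˡ x _ _) (+-cong (*-distribˡ-∑ᶜ k x _) (*-distribˡ-∑ᶜ k x _))

  ∑ᶜ-zero : ∀ k → ∑ᶜ k (λ _ → 0#) ≈ 0#
  ∑ᶜ-zero zero    = ≈-refl
  ∑ᶜ-zero (suc k) = ≈-trans (+-cong (∑ᶜ-zero k) (∑ᶜ-zero k)) (+-identityˡ 0#)

  ∑ᶜ-∑-comm : ∀ k {n} (f : Vec Bool k → Fin n → Carrier) →
              ∑ᶜ k (λ m → sum (f m)) ≈ sum (λ j → ∑ᶜ k (λ m → f m j))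
  ∑ᶜ-∑-comm k {zero}  f = ∑ᶜ-zero k
  ∑ᶜ-∑-comm k {suc n} f =
    ≈-trans (∑ᶜ-distrib-+ k _ _) (+-congˡ (∑ᶜ-∑-comm k (λ m → f m ∘ suc)))

  ∑ᶜ-comm : ∀ k l (f : Vec Bool k → Vec Bool l → Carrier) →
            ∑ᶜ k (λ a → ∑ᶜ l (f a)) ≈ ∑ᶜ l (λ b → ∑ᶜ k (λ a → f a b))
  ∑ᶜ-comm zero    l f = ≈-refl
  ∑ᶜ-comm (suc k) l f =
    ≈-trans (+-cong (∑ᶜ-comm k l _) (∑ᶜ-comm k l _)) (≈-sym (∑ᶜ-distrib-+ l _ _))

  ∑ᶜ-translate : ∀ k (f : Vec Bool k → Carrier) (u : Vec Bool k) →
                 ∑ᶜ k (λ z → f (z ⊕ u)) ≈ ∑ᶜ k f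
  ∑ᶜ-translate zero    f []          = ≈-refl
  ∑ᶜ-translate (suc k) f (false ∷ u) =
    +-cong (∑ᶜ-translate k (f ∘ (false ∷_)) u) (∑ᶜ-translate k (f ∘ (true ∷_)) u)
  ∑ᶜ-translate (suc k) f (true ∷ u)  =
    ≈-trans (+-cong (∑ᶜ-translate k (f ∘ (true ∷_)) u) (∑ᶜ-translate k (f ∘ (false ∷_)) u))
          (+-comm _ _)

  ∑ᶜ-pointMass₀ : ∀ k (f : Vec Bool k → Carrier) →
                  (∀ v → v ≢ zeroVec k → f v ≈ 0#) → ∑ᶜ k f ≈ f (zeroVec k)
  ∑ᶜ-pointMass₀ zero    f f≈0 = ≈-refl
  ∑ᶜ-pointMass₀ (suc k) f f≈0 = begin
    ∑ᶜ k (f ∘ (false ∷_)) + ∑ᶜ k (f ∘ (true ∷_))  ≈⟨ +-cong (∑ᶜ-pointMass₀ k _ (λ v v≢0 → f≈0 _ (v≢0 ∘ Vecₚ.∷-injectiveʳ)))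
                                                            (∑ᶜ-cong k (λ v → f≈0 _ λ ())) ⟩
    f (zeroVec (suc k)) + ∑ᶜ k (λ _ → 0#)           ≈⟨ +-congˡ (∑ᶜ-zero k) ⟩
    f (zeroVec (suc k)) + 0#                        ≈⟨ +-identityʳ _ ⟩
    f (zeroVec (suc k))                             ∎

  ∑ᶜ-pointMass : ∀ k (f : Vec Bool k → Carrier) (u : Vec Bool k) →
                 (∀ v → v ≢ u → f v ≈ 0#) → ∑ᶜ k f ≈ f u
  ∑ᶜ-pointMass k f u f≈0 = begin
    ∑ᶜ k f                   ≈⟨ ∑ᶜ-translate k f u ⟨
    ∑ᶜ k (λ z → f (z ⊕ u))   ≈⟨ ∑ᶜ-pointMass₀ k _ (λ z z≢0 → f≈0 _ (z≢0 ∘ shift)) ⟩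
    f (zeroVec k ⊕ u)        ≡⟨ cong f (⊕-identityˡ u) ⟩
    f u                      ∎
    where
    shift : ∀ {z} → z ⊕ u ≡ u → z ≡ zeroVec k
    shift {z} e = trans (sym (⊕-cancelʳ z u)) (trans (cong (_⊕ u) e) (⊕-self u))

open import Data.Nat using (_+_; _*_; _∸_; _^_; _⊓_; _≤_; _<_; z≤n; s≤s)
import Data.Nat.Properties as ℕₚ
open import Data.Nat.Divisibility using (_∣_; _∣?_; m∣m*n)
open import Data.Nat.Tactic.RingSolver using (solve-∀)
open import Algebra.Properties.Semiring.Sum ℕₚ.+-*-semiring
  using (sum; sum-syntax; sum-cong-≗; ∑-distrib-+; *-distribˡ-sum; sum-replicate-zero)
open CubeSum ℕₚ.+-*-semiring

∑-const : ∀ n c → ∑[ j < n ] c ≡ n * c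
∑-const zero    c = refl
∑-const (suc n) c = cong (c +_) (∑-const n c)

term≤∑ : ∀ {n} (f : Fin n → ℕ) j → f j ≤ sum f
term≤∑ f zero    = ℕₚ.m≤m+n _ _
term≤∑ f (suc j) = ℕₚ.≤-trans (term≤∑ (f ∘ suc) j) (ℕₚ.m≤n+m _ _)

twoTerms≤∑ : ∀ {n} (f : Fin n → ℕ) {j l} → j ≢ l → f j + f l ≤ sum f
twoTerms≤∑ f {zero}  {zero}  j≢l = contradiction refl j≢l
twoTerms≤∑ f {zero}  {suc l} j≢l = ℕₚ.+-monoʳ-≤ (f zero) (term≤∑ (f ∘ suc) l)
twoTerms≤∑ f {suc j} {zero}  j≢l =
  subst (_≤ sum f) (ℕₚ.+-comm (f zero) _) (ℕₚ.+-monoʳ-≤ (f zero) (term≤∑ (f ∘ suc) j))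
twoTerms≤∑ f {suc j} {suc l} j≢l =
  ℕₚ.≤-trans (twoTerms≤∑ (f ∘ suc) (j≢l ∘ cong suc)) (ℕₚ.m≤n+m _ _)

∑ᶜ-const : ∀ k c → ∑ᶜ k (λ _ → c) ≡ 2 ^ k * c
∑ᶜ-const zero    c = sym (ℕₚ.+-identityʳ c)
∑ᶜ-const (suc k) c = begin
  ∑ᶜ k (λ _ → c) + ∑ᶜ k (λ _ → c)  ≡⟨ cong₂ _+_ (∑ᶜ-const k c) (∑ᶜ-const k c) ⟩
  2 ^ k * c + 2 ^ k * c            ≡⟨ ℕₚ.*-distribʳ-+ c (2 ^ k) (2 ^ k) ⟨
  (2 ^ k + 2 ^ k) * c              ≡⟨ cong (λ t → (2 ^ k + t) * c) (ℕₚ.+-identityʳ (2 ^ k)) ⟨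
  2 ^ suc k * c                    ∎
  where open ≡-Reasoning

∑ᶜ-mono-≤ : ∀ k {f g : Vec Bool k → ℕ} → (∀ m → f m ≤ g m) → ∑ᶜ k f ≤ ∑ᶜ k g
∑ᶜ-mono-≤ zero    f≤g = f≤g []
∑ᶜ-mono-≤ (suc k) f≤g = ℕₚ.+-mono-≤ (∑ᶜ-mono-≤ k (f≤g ∘ (false ∷_))) (∑ᶜ-mono-≤ k (f≤g ∘ (true ∷_)))

term≤∑ᶜ : ∀ k (f : Vec Bool k → ℕ) u → f u ≤ ∑ᶜ k f
term≤∑ᶜ zero    f []          = ℕₚ.≤-refl
term≤∑ᶜ (suc k) f (false ∷ u) = ℕₚ.≤-trans (term≤∑ᶜ k (f ∘ (false ∷_)) u) (ℕₚ.m≤m+n _ _)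
term≤∑ᶜ (suc k) f (true ∷ u)  = ℕₚ.≤-trans (term≤∑ᶜ k (f ∘ (true ∷_)) u) (ℕₚ.m≤n+m _ _)

twoTerms≤∑ᶜ : ∀ k (f : Vec Bool k → ℕ) {u w} → u ≢ w → f u + f w ≤ ∑ᶜ k f
twoTerms≤∑ᶜ zero    f {[]}        {[]}        u≢w = contradiction refl u≢w
twoTerms≤∑ᶜ (suc k) f {false ∷ u} {false ∷ w} u≢w =
  ℕₚ.≤-trans (twoTerms≤∑ᶜ k (f ∘ (false ∷_)) (u≢w ∘ cong (false ∷_))) (ℕₚ.m≤m+n _ _)
twoTerms≤∑ᶜ (suc k) f {true ∷ u}  {true ∷ w}  u≢w =
  ℕₚ.≤-trans (twoTerms≤∑ᶜ k (f ∘ (true ∷_)) (u≢w ∘ cong (true ∷_))) (ℕₚ.m≤n+m _ _)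
twoTerms≤∑ᶜ (suc k) f {false ∷ u} {true ∷ w}  u≢w =
  ℕₚ.+-mono-≤ (term≤∑ᶜ k (f ∘ (false ∷_)) u) (term≤∑ᶜ k (f ∘ (true ∷_)) w)
twoTerms≤∑ᶜ (suc k) f {true ∷ u}  {false ∷ w} u≢w =
  subst (_≤ ∑ᶜ (suc k) f) (ℕₚ.+-comm (f (false ∷ w)) _)
        (ℕₚ.+-mono-≤ (term≤∑ᶜ k (f ∘ (false ∷_)) w) (term≤∑ᶜ k (f ∘ (true ∷_)) u))

∑∑-symmetric : ∀ n (d : Fin n → Fin n → ℕ) → (∀ j l → d j l ≡ d l j) →
               ∃ λ t → ∑[ j < n ] ∑[ l < n ] d j l ≡ ∑[ j < n ] d j j + 2 * t
∑∑-symmetric zero    d d-sym = 0 , refl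
∑∑-symmetric (suc n) d d-sym with ∑∑-symmetric n (λ j l → d (suc j) (suc l)) (λ j l → d-sym (suc j) (suc l))
... | t , eq = row + t , (begin
  (d₀₀ + row) + ∑[ j < n ] (d (suc j) zero + ∑[ l < n ] d (suc j) (suc l))
    ≡⟨ cong ((d₀₀ + row) +_) (∑-distrib-+ (λ j → d (suc j) zero) _) ⟩
  (d₀₀ + row) + (∑[ j < n ] d (suc j) zero + ∑[ j < n ] ∑[ l < n ] d (suc j) (suc l))
    ≡⟨ cong₂ (λ a b → (d₀₀ + row) + (a + b)) (sum-cong-≗ (λ j → d-sym (suc j) zero)) eq ⟩
  (d₀₀ + row) + (row + (diag + 2 * t))
    ≡⟨ regroup d₀₀ row diag t ⟩
  (d₀₀ + diag) + 2 * (row + t)  ∎)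
  where
  open ≡-Reasoning
  d₀₀ row diag : ℕ
  d₀₀  = d zero zero
  row  = ∑[ l < n ] d zero (suc l)
  diag = ∑[ j < n ] d (suc j) (suc j)
  regroup : ∀ a r e t → (a + r) + (r + (e + 2 * t)) ≡ (a + e) + 2 * (r + t)
  regroup = solve-∀

module Columns {n k : ℕ} (G : Generator n k) where

  mult : Vec Bool k → ℕ
  mult v = ∑[ j < n ] δ₀ (v ⊕ col G j)

  pairs : Vec Bool k → ℕ
  pairs v = ∑[ j < n ] mult (v ⊕ col G j)

  excess : ℕ
  excess = ∑[ j < n ] (mult (col G j) ∸ 1)

  ∑ᶜ-*-mult : ∀ (f : Vec Bool k → ℕ) → ∑ᶜ k (λ v → f v * mult v) ≡ ∑[ j < n ] f (col G j)
  ∑ᶜ-*-mult f = begin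
    ∑ᶜ k (λ v → f v * mult v)                           ≡⟨ ∑ᶜ-cong k (λ v → *-distribˡ-sum (f v) (λ j → δ₀ (v ⊕ col G j))) ⟩
    ∑ᶜ k (λ v → ∑[ j < n ] (f v * δ₀ (v ⊕ col G j)))    ≡⟨ ∑ᶜ-∑-comm k (λ v j → f v * δ₀ (v ⊕ col G j)) ⟩
    ∑[ j < n ] ∑ᶜ k (λ v → f v * δ₀ (v ⊕ col G j))      ≡⟨ sum-cong-≗ atColumn ⟩
    ∑[ j < n ] f (col G j)                              ∎
    where
    open ≡-Reasoning
    atColumn : ∀ j → ∑ᶜ k (λ v → f v * δ₀ (v ⊕ col G j)) ≡ f (col G j)
    atColumn j = trans (∑ᶜ-pointMass k _ (col G j)
                         (λ v v≢c → trans (cong (f v *_) (δ₀-⊕-≢ v≢c)) (ℕₚ.*-zeroʳ (f v))))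
                       (trans (cong (f (col G j) *_) (δ₀-⊕-self (col G j))) (ℕₚ.*-identityʳ _))

  pairs≡∑ᶜ : ∀ v → pairs v ≡ ∑ᶜ k (λ a → mult (v ⊕ a) * mult a)
  pairs≡∑ᶜ v = sym (∑ᶜ-*-mult (λ a → mult (v ⊕ a)))

  pairs-⊕-≥ : ∀ {u w} → u ≢ w → mult w * mult u + mult u * mult w ≤ pairs (u ⊕ w)
  pairs-⊕-≥ {u} {w} u≢w = begin
    mult w * mult u + mult u * mult w             ≡⟨ cong₂ (λ a b → mult a * mult u + mult b * mult w)
                                                          (⊕-cancelˡ u w) (⊕-cancelʳ u w) ⟨
    f u + f w                                     ≤⟨ twoTerms≤∑ᶜ k f u≢w ⟩
    ∑ᶜ k f                                        ≡⟨ pairs≡∑ᶜ (u ⊕ w) ⟨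
    pairs (u ⊕ w)                                 ∎
    where
    open ℕₚ.≤-Reasoning
    f : Vec Bool k → ℕ
    f a = mult ((u ⊕ w) ⊕ a) * mult a

  mult-col : ∀ j → 1 ≤ mult (col G j)
  mult-col j = subst (_≤ mult (col G j)) (δ₀-⊕-self (col G j)) (term≤∑ (λ l → δ₀ (col G j ⊕ col G l)) j)

  ∑-mult-col : ∑[ j < n ] mult (col G j) ≡ n + excess
  ∑-mult-col = begin
    ∑[ j < n ] mult (col G j)                  ≡⟨ sum-cong-≗ (λ j → ℕₚ.m+[n∸m]≡n (mult-col j)) ⟨
    ∑[ j < n ] (1 + (mult (col G j) ∸ 1))      ≡⟨ ∑-distrib-+ (λ _ → 1) (λ j → mult (col G j) ∸ 1) ⟩
    ∑[ j < n ] 1 + excess                      ≡⟨ cong (_+ excess) (trans (∑-const n 1) (ℕₚ.*-identityʳ n)) ⟩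
    n + excess                                 ∎
    where open ≡-Reasoning

  pairs-zero : pairs (zeroVec k) ≡ n + excess
  pairs-zero = trans (sum-cong-≗ (λ j → cong mult (⊕-identityˡ (col G j)))) ∑-mult-col

  excess-even : ∃ λ t → excess ≡ 2 * t
  excess-even with ∑∑-symmetric n (λ j l → δ₀ (col G j ⊕ col G l)) (λ j l → cong δ₀ (⊕-comm (col G j) (col G l)))
  ... | t , eq = t , ℕₚ.+-cancelˡ-≡ n excess (2 * t) (begin
    n + excess                                   ≡⟨ ∑-mult-col ⟨
    ∑[ j < n ] mult (col G j)                    ≡⟨ eq ⟩
    ∑[ j < n ] δ₀ (col G j ⊕ col G j) + 2 * t    ≡⟨ cong (_+ 2 * t) diagonal ⟩
    n + 2 * t                                    ∎)
    where
    open ≡-Reasoning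
    diagonal : ∑[ j < n ] δ₀ (col G j ⊕ col G j) ≡ n
    diagonal = trans (sum-cong-≗ (λ j → δ₀-⊕-self (col G j))) (trans (∑-const n 1) (ℕₚ.*-identityʳ n))

  MultiplicityFree : Set
  MultiplicityFree = ∀ j → mult (col G j) ≤ 1

  multiplicityFree⇒excess≡0 : MultiplicityFree → excess ≡ 0
  multiplicityFree⇒excess≡0 free = trans (sum-cong-≗ (λ j → ℕₚ.m≤n⇒m∸n≡0 (free j))) (sum-replicate-zero n)

  excess≡0⇒multiplicityFree : excess ≡ 0 → MultiplicityFree
  excess≡0⇒multiplicityFree excess≡0 j =
    ℕₚ.m∸n≡0⇒m≤n (ℕₚ.n≤0⇒n≡0 (subst (mult (col G j) ∸ 1 ≤_) excess≡0 (term≤∑ (λ l → mult (col G l) ∸ 1) j)))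

  -- Two distinct repeated column values u, w would give pairs (u ⊕ w) ≥ 8.
  excess-pronic : (∀ v → v ≢ zeroVec k → pairs v < 8) → ∃ λ m → excess ≡ (m ∸ 1) * m
  excess-pronic few with Finₚ.any? (λ j → 2 ℕₚ.≤? mult (col G j))
  ... | no noneRepeated = 0 , multiplicityFree⇒excess≡0 (λ j → ℕₚ.≤-pred (ℕₚ.≰⇒> (noneRepeated ∘ (j ,_))))
  ... | yes (j₀ , 2≤m) = m , (begin
    excess                                      ≡⟨ sum-cong-≗ excessAt ⟩
    ∑[ l < n ] ((m ∸ 1) * δ₀ (u ⊕ col G l))     ≡⟨ *-distribˡ-sum (m ∸ 1) (λ l → δ₀ (u ⊕ col G l)) ⟨
    (m ∸ 1) * m                                 ∎)
    where
    open ≡-Reasoning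
    u : Vec Bool k
    u = col G j₀
    m : ℕ
    m = mult u
    notRepeated : ∀ {c} → u ≢ c → mult c ≤ 1
    notRepeated {c} u≢c with 2 ℕₚ.≤? mult c
    ... | no  2≰c = ℕₚ.≤-pred (ℕₚ.≰⇒> 2≰c)
    ... | yes 2≤c = contradiction (ℕₚ.≤-trans (ℕₚ.+-mono-≤ (ℕₚ.*-mono-≤ 2≤c 2≤m) (ℕₚ.*-mono-≤ 2≤m 2≤c))
                                              (pairs-⊕-≥ u≢c))
                                  (ℕₚ.<⇒≱ (few (u ⊕ c) (u≢c ∘ ⊕≡zero⇒≡)))
    excessAt : ∀ l → mult (col G l) ∸ 1 ≡ (m ∸ 1) * δ₀ (u ⊕ col G l)
    excessAt l with u ≟ᵛ col G l
    ... | no  u≢c = trans (ℕₚ.m≤n⇒m∸n≡0 (notRepeated u≢c))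
                          (sym (trans (cong ((m ∸ 1) *_) (δ₀-⊕-≢ u≢c)) (ℕₚ.*-zeroʳ (m ∸ 1))))
    ... | yes u≡c = begin
      mult (col G l) ∸ 1              ≡⟨ cong (λ c → mult c ∸ 1) u≡c ⟨
      m ∸ 1                           ≡⟨ ℕₚ.*-identityʳ (m ∸ 1) ⟨
      (m ∸ 1) * 1                     ≡⟨ cong ((m ∸ 1) *_) (δ₀-⊕-self u) ⟨
      (m ∸ 1) * δ₀ (u ⊕ u)            ≡⟨ cong (λ c → (m ∸ 1) * δ₀ (u ⊕ c)) u≡c ⟩
      (m ∸ 1) * δ₀ (u ⊕ col G l)      ∎

  mult-zero : (∀ j → col G j ≢ zeroVec k) → mult (zeroVec k) ≡ 0
  mult-zero col≢0 = trans (sum-cong-≗ (λ j → trans (cong δ₀ (⊕-identityˡ (col G j))) (δ₀-nonzero (col≢0 j))))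
                          (sum-replicate-zero n)

  equalColumns⇒repeated : ∀ {j l} → j ≢ l → col G j ≡ col G l → 2 ≤ mult (col G j)
  equalColumns⇒repeated {j} {l} j≢l cj≡cl = subst (_≤ mult (col G j)) bothOne (twoTerms≤∑ f j≢l)
    where
    f : Fin n → ℕ
    f i = δ₀ (col G j ⊕ col G i)
    bothOne : f j + f l ≡ 2
    bothOne = cong₂ _+_ (δ₀-⊕-self (col G j)) (trans (cong (λ c → δ₀ (col G j ⊕ c)) (sym cj≡cl)) (δ₀-⊕-self (col G j)))

  shell⇒multiplicityFree : ∀ c y → y < 2 * c → (∀ j → col G j ≢ zeroVec k) →
                           (∀ {v} → v ≢ zeroVec k → pairs v + c * mult v ≡ y) → MultiplicityFree
  shell⇒multiplicityFree c y y<2c col≢0 shell j with mult (col G j) ℕₚ.≤? 1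
  ... | yes ≤1 = ≤1
  ... | no  ≰1 = contradiction (begin
    2 * c                              ≡⟨ ℕₚ.*-comm 2 c ⟩
    c * 2                              ≤⟨ ℕₚ.*-monoʳ-≤ c (ℕₚ.≰⇒> ≰1) ⟩
    c * mult (col G j)                 ≤⟨ ℕₚ.m≤n+m _ (pairs (col G j)) ⟩
    pairs (col G j) + c * mult (col G j) ≡⟨ shell (col≢0 j) ⟩
    y                                  ∎) (ℕₚ.<⇒≱ y<2c)
    where open ℕₚ.≤-Reasoning

combination : ∀ {n k} → Vec Bool n → (Fin n → Vec Bool k) → Vec Bool k
combination {k = k} []          cs = zeroVec k
combination         (true ∷ x)  cs = cs zero ⊕ combination x (cs ∘ suc)
combination         (false ∷ x) cs = combination x (cs ∘ suc)

dot-combination : ∀ {n k} (x c : Vec Bool n) (cs : Fin n → Vec Bool k) (m : Vec Bool k) →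
                  (∀ j → lookup c j ≡ dot m (cs j)) → dot x c ≡ dot m (combination x cs)
dot-combination []          []      cs m c≡ = sym (dot-zeroʳ m)
dot-combination (false ∷ x) (a ∷ c) cs m c≡ = dot-combination x c (cs ∘ suc) m (c≡ ∘ suc)
dot-combination (true ∷ x)  (a ∷ c) cs m c≡ =
  trans (cong₂ _xor_ (c≡ zero) (dot-combination x c (cs ∘ suc) m (c≡ ∘ suc)))
        (sym (dot-distribˡ-⊕ m (cs zero) _))

orthogonalToAll⇒zero : ∀ {k} (y : Vec Bool k) → (∀ m → dot m y ≡ false) → y ≡ zeroVec k
orthogonalToAll⇒zero []              y⊥ = refl
orthogonalToAll⇒zero {suc k} (a ∷ y) y⊥ =
  cong₂ _∷_ (trans (sym (Boolₚ.xor-identityʳ a)) (trans (cong (a xor_) (sym (dot-zeroˡ y))) (y⊥ (true ∷ zeroVec k))))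
            (orthogonalToAll⇒zero y (y⊥ ∘ (false ∷_)))

dual⇒combination≡zero : ∀ {n k} (G : Generator n k) x → x ∈Dual G → combination x (col G) ≡ zeroVec k
dual⇒combination≡zero G x x⊥ = orthogonalToAll⇒zero _ λ m →
  trans (sym (dot-combination x (encode G m) (col G) m (lookup-encode G m))) (x⊥ (encode G m) (m , refl))

combination-wt≡0 : ∀ {n k} (x : Vec Bool n) (cs : Fin n → Vec Bool k) → wt x ≡ 0 →
                   combination x cs ≡ zeroVec k
combination-wt≡0 []          cs wt≡0 = refl
combination-wt≡0 (false ∷ x) cs wt≡0 = combination-wt≡0 x (cs ∘ suc) wt≡0

combination-wt≤1 : ∀ {n k} (x : Vec Bool n) (cs : Fin n → Vec Bool k) → wt x ≤ 1 →
                   (combination x cs ≡ zeroVec k) ⊎ ∃ (λ l → combination x cs ≡ cs l)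
combination-wt≤1 []          cs wt≤1 = inj₁ refl
combination-wt≤1 (false ∷ x) cs wt≤1 with combination-wt≤1 x (cs ∘ suc) wt≤1
... | inj₁ ≡0       = inj₁ ≡0
... | inj₂ (l , ≡l) = inj₂ (suc l , ≡l)
combination-wt≤1 (true ∷ x)  cs (s≤s wt≤0) =
  inj₂ (zero , trans (cong (cs zero ⊕_) (combination-wt≡0 x (cs ∘ suc) (ℕₚ.n≤0⇒n≡0 wt≤0))) (⊕-identityʳ (cs zero)))

lightDependency⇒repetition : ∀ {n k} (x : Vec Bool n) (cs : Fin n → Vec Bool k) →
  (∀ j → cs j ≢ zeroVec k) → combination x cs ≡ zeroVec k → x ≢ zeroVec n → wt x ≤ 2 →
  ∃ λ j → ∃ λ l → j ≢ l × cs j ≡ cs l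
lightDependency⇒repetition []          cs cs≢0 ≡0 x≢0 wt≤2 = contradiction refl x≢0
lightDependency⇒repetition (false ∷ x) cs cs≢0 ≡0 x≢0 wt≤2
  with lightDependency⇒repetition x (cs ∘ suc) (cs≢0 ∘ suc) ≡0 (x≢0 ∘ cong (false ∷_)) wt≤2
... | j , l , j≢l , cj≡cl = suc j , suc l , j≢l ∘ Finₚ.suc-injective , cj≡cl
lightDependency⇒repetition (true ∷ x)  cs cs≢0 ≡0 x≢0 (s≤s wt≤1) with combination-wt≤1 x (cs ∘ suc) wt≤1
... | inj₁ rest≡0 = contradiction (trans (sym (⊕-identityʳ (cs zero))) (trans (cong (cs zero ⊕_) (sym rest≡0)) ≡0))
                                  (cs≢0 zero)
... | inj₂ (l , rest≡cl) = zero , suc l , (λ ()) , trans (⊕≡zero⇒≡ ≡0) rest≡cl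

fullLength⇒col≢zero : ∀ {n k} (G : Generator n k) → FullLength G → ∀ j → col G j ≢ zeroVec k
fullLength⇒col≢zero G full j col≡0 with full j
... | c , (m , mG≡c) , cⱼ≡true = contradiction (begin
  false                   ≡⟨ dot-zeroʳ m ⟨
  dot m (zeroVec _)       ≡⟨ cong (dot m) col≡0 ⟨
  dot m (col G j)         ≡⟨ lookup-encode G m j ⟨
  lookup (encode G m) j   ≡⟨ cong (λ c → lookup c j) mG≡c ⟩
  lookup c j              ≡⟨ cⱼ≡true ⟩
  true                    ∎) (λ ())
  where open ≡-Reasoning

multiplicityFree⇒projective : ∀ {n k} (G : Generator n k) → (∀ j → col G j ≢ zeroVec k) →
                              Columns.MultiplicityFree G → Projective G
multiplicityFree⇒projective G col≢0 free x x⊥ x≢0 with wt x ℕₚ.≤? 2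
... | no  wt≰2 = ℕₚ.≰⇒> wt≰2
... | yes wt≤2 with lightDependency⇒repetition x (col G) col≢0 (dual⇒combination≡zero G x x⊥) x≢0 wt≤2
...   | j , l , j≢l , cj≡cl = contradiction (free j) (ℕₚ.<⇒≱ (Columns.equalColumns⇒repeated G j≢l cj≡cl))

open import Data.Integer as ℤ using (ℤ; +_; -1ℤ)
import Data.Integer.Properties as ℤₚ
import Data.Integer.Tactic.RingSolver as ℤ-Solver
import Algebra.Properties.Semiring.Sum ℤₚ.+-*-semiring as ℤΣ
module ℤᶜ = CubeSum ℤₚ.+-*-semiring

σ : Bool → ℤ
σ false = + 1
σ true  = -1ℤ

σ-xor : ∀ a b → σ (a xor b) ≡ σ a ℤ.* σ b
σ-xor false false = refl
σ-xor false true  = refl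
σ-xor true  false = refl
σ-xor true  true  = refl

pos-sum : ∀ {n} (f : Fin n → ℕ) → + sum f ≡ ℤΣ.sum (λ j → + f j)
pos-sum {zero}  f = refl
pos-sum {suc n} f = trans (ℤₚ.pos-+ (f zero) _) (cong (ℤ._+_ (+ f zero)) (pos-sum (f ∘ suc)))

∑ᶜ-σ-dot : ∀ k (v : Vec Bool k) → ℤᶜ.∑ᶜ k (λ m → σ (dot m v)) ≡ + (2 ^ k * δ₀ v)
∑ᶜ-σ-dot zero    []          = refl
∑ᶜ-σ-dot (suc k) (false ∷ v) = begin
  S ℤ.+ S                                ≡⟨ cong₂ ℤ._+_ (∑ᶜ-σ-dot k v) (∑ᶜ-σ-dot k v) ⟩
  + (2 ^ k * δ₀ v) ℤ.+ + (2 ^ k * δ₀ v)  ≡⟨ ℤₚ.pos-+ (2 ^ k * δ₀ v) _ ⟨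
  + (2 ^ k * δ₀ v + 2 ^ k * δ₀ v)        ≡⟨ cong +_ (double (2 ^ k) (δ₀ v)) ⟩
  + (2 ^ suc k * δ₀ v)                   ∎
  where
  open ≡-Reasoning
  S : ℤ
  S = ℤᶜ.∑ᶜ k (λ m → σ (dot m v))
  double : ∀ a b → a * b + a * b ≡ (2 * a) * b
  double = solve-∀
∑ᶜ-σ-dot (suc k) (true ∷ v)  = begin
  S ℤ.+ ℤᶜ.∑ᶜ k (λ m → σ (true xor dot m v))  ≡⟨ cong (ℤ._+_ S) (ℤᶜ.∑ᶜ-cong k (λ m → σ-xor true (dot m v))) ⟩
  S ℤ.+ ℤᶜ.∑ᶜ k (λ m → -1ℤ ℤ.* σ (dot m v))   ≡⟨ cong (ℤ._+_ S) (ℤᶜ.*-distribˡ-∑ᶜ k -1ℤ _) ⟨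
  S ℤ.+ -1ℤ ℤ.* S                             ≡⟨ cong (ℤ._+_ S) (ℤₚ.-1*i≡-i S) ⟩
  S ℤ.+ ℤ.- S                                 ≡⟨ ℤₚ.+-inverseʳ S ⟩
  + 0                                         ≡⟨ cong +_ (ℕₚ.*-zeroʳ (2 ^ suc k)) ⟨
  + (2 ^ suc k * 0)                           ∎
  where
  open ≡-Reasoning
  S : ℤ
  S = ℤᶜ.∑ᶜ k (λ m → σ (dot m v))

∑-σ-lookup : ∀ {n} (c : Vec Bool n) → ℤΣ.sum (λ j → σ (lookup c j)) ≡ + n ℤ.- + 2 ℤ.* + wt c
∑-σ-lookup []                = refl
∑-σ-lookup {suc n} (false ∷ c) = trans (cong (ℤ._+_ (+ 1)) (∑-σ-lookup c)) (step (+ n) (+ wt c))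
  where
  step : ∀ N W → + 1 ℤ.+ (N ℤ.- + 2 ℤ.* W) ≡ (+ 1 ℤ.+ N) ℤ.- + 2 ℤ.* W
  step = ℤ-Solver.solve-∀
∑-σ-lookup {suc n} (true ∷ c)  = trans (cong (ℤ._+_ -1ℤ) (∑-σ-lookup c)) (step (+ n) (+ wt c))
  where
  step : ∀ N W → -1ℤ ℤ.+ (N ℤ.- + 2 ℤ.* W) ≡ (+ 1 ℤ.+ N) ℤ.- + 2 ℤ.* (+ 1 ℤ.+ W)
  step = ℤ-Solver.solve-∀

module Moments {n k : ℕ} (G : Generator n k) where

  open Columns G

  bias : Vec Bool k → ℤ
  bias m = ℤΣ.sum (λ j → σ (dot m (col G j)))

  bias≡ : ∀ m → bias m ≡ + n ℤ.- + 2 ℤ.* + wt (encode G m)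
  bias≡ m = trans (ℤΣ.sum-cong-≗ (λ j → cong σ (sym (lookup-encode G m j)))) (∑-σ-lookup (encode G m))

  σ-*-bias : ∀ m w → σ (dot m w) ℤ.* bias m ≡ ℤΣ.sum (λ j → σ (dot m (w ⊕ col G j)))
  σ-*-bias m w = trans (ℤΣ.*-distribˡ-sum {n} (σ (dot m w)) _)
    (ℤΣ.sum-cong-≗ (λ j → sym (trans (cong σ (dot-distribˡ-⊕ m w (col G j))) (σ-xor (dot m w) _))))

  firstMoment : ∀ v → ℤᶜ.∑ᶜ k (λ m → σ (dot m v) ℤ.* bias m) ≡ + (2 ^ k * mult v)
  firstMoment v = begin
    ℤᶜ.∑ᶜ k (λ m → σ (dot m v) ℤ.* bias m)                          ≡⟨ ℤᶜ.∑ᶜ-cong k (λ m → σ-*-bias m v) ⟩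
    ℤᶜ.∑ᶜ k (λ m → ℤΣ.sum (λ j → σ (dot m (v ⊕ col G j))))         ≡⟨ ℤᶜ.∑ᶜ-∑-comm k {n} _ ⟩
    ℤΣ.sum (λ j → ℤᶜ.∑ᶜ k (λ m → σ (dot m (v ⊕ col G j))))         ≡⟨ ℤΣ.sum-cong-≗ (λ j → ∑ᶜ-σ-dot k (v ⊕ col G j)) ⟩
    ℤΣ.sum (λ j → + (2 ^ k * δ₀ (v ⊕ col G j)))                     ≡⟨ pos-sum {n} _ ⟨
    + (∑[ j < n ] (2 ^ k * δ₀ (v ⊕ col G j)))                       ≡⟨ cong +_ (*-distribˡ-sum {n} (2 ^ k) _) ⟨
    + (2 ^ k * mult v)                                              ∎
    where open ≡-Reasoning

  secondMoment : ∀ v → ℤᶜ.∑ᶜ k (λ m → σ (dot m v) ℤ.* (bias m ℤ.* bias m)) ≡ + (2 ^ k * pairs v)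
  secondMoment v = begin
    ℤᶜ.∑ᶜ k (λ m → σ (dot m v) ℤ.* (bias m ℤ.* bias m))                    ≡⟨ ℤᶜ.∑ᶜ-cong k expand ⟩
    ℤᶜ.∑ᶜ k (λ m → ℤΣ.sum (λ j → σ (dot m (v ⊕ col G j)) ℤ.* bias m))     ≡⟨ ℤᶜ.∑ᶜ-∑-comm k {n} _ ⟩
    ℤΣ.sum (λ j → ℤᶜ.∑ᶜ k (λ m → σ (dot m (v ⊕ col G j)) ℤ.* bias m))     ≡⟨ ℤΣ.sum-cong-≗ (λ j → firstMoment (v ⊕ col G j)) ⟩
    ℤΣ.sum (λ j → + (2 ^ k * mult (v ⊕ col G j)))                          ≡⟨ pos-sum {n} _ ⟨
    + (∑[ j < n ] (2 ^ k * mult (v ⊕ col G j)))                            ≡⟨ cong +_ (*-distribˡ-sum {n} (2 ^ k) _) ⟨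
    + (2 ^ k * pairs v)                                                    ∎
    where
    open ≡-Reasoning
    expand : ∀ m → σ (dot m v) ℤ.* (bias m ℤ.* bias m) ≡ ℤΣ.sum (λ j → σ (dot m (v ⊕ col G j)) ℤ.* bias m)
    expand m = trans (sym (ℤₚ.*-assoc (σ (dot m v)) (bias m) (bias m)))
                     (trans (cong (ℤ._* bias m) (σ-*-bias m v)) (ℤΣ.*-distribʳ-sum {n} (bias m) _))

wt-zero : ∀ n → wt (zeroVec n) ≡ 0
wt-zero zero    = refl
wt-zero (suc n) = wt-zero n

module TwoWeight {n k : ℕ} (G : Generator n k) (independent : LinIndep G) (w₁ w₂ : ℕ)
  (twoWeights : ∀ c → c ∈C G → c ≢ zeroVec n → (wt c ≡ w₁) ⊎ (wt c ≡ w₂)) where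

  open Columns G
  open Moments G

  shift₁ shift₂ : ℤ
  shift₁ = + n ℤ.- + 2 ℤ.* + w₁
  shift₂ = + n ℤ.- + 2 ℤ.* + w₂

  -- bias m = n - 2 wt(mG), so P annihilates the bias of every nonzero message.
  P : ℤ → ℤ
  P x = (x ℤ.- shift₁) ℤ.* (x ℤ.- shift₂)

  P-bias-zero : P (bias (zeroVec k)) ≡ + 4 ℤ.* + w₁ ℤ.* + w₂
  P-bias-zero = begin
    P (bias (zeroVec k))                           ≡⟨ cong P (bias≡ (zeroVec k)) ⟩
    P (+ n ℤ.- + 2 ℤ.* + wt (encode G (zeroVec k))) ≡⟨ cong (λ c → P (+ n ℤ.- + 2 ℤ.* + wt c)) (encode-zero G) ⟩
    P (+ n ℤ.- + 2 ℤ.* + wt (zeroVec n))           ≡⟨ cong (λ w → P (+ n ℤ.- + 2 ℤ.* + w)) (wt-zero n) ⟩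
    P (+ n ℤ.- + 2 ℤ.* + 0)                        ≡⟨ atZero (+ n) (+ w₁) (+ w₂) ⟩
    + 4 ℤ.* + w₁ ℤ.* + w₂                          ∎
    where
    open ≡-Reasoning
    atZero : ∀ N A B → ((N ℤ.- + 2 ℤ.* + 0) ℤ.- (N ℤ.- + 2 ℤ.* A)) ℤ.* ((N ℤ.- + 2 ℤ.* + 0) ℤ.- (N ℤ.- + 2 ℤ.* B))
                       ≡ + 4 ℤ.* A ℤ.* B
    atZero = ℤ-Solver.solve-∀

  P-bias-nonzero : ∀ {m} → m ≢ zeroVec k → P (bias m) ≡ + 0
  P-bias-nonzero {m} m≢0 =
    trans (cong P (bias≡ m)) (atWeight (twoWeights (encode G m) (m , refl) (m≢0 ∘ independent m)))
    where
    atWeight : ∀ {w} → (w ≡ w₁) ⊎ (w ≡ w₂) → P (+ n ℤ.- + 2 ℤ.* + w) ≡ + 0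
    atWeight (inj₁ w≡w₁) = trans (cong (λ w → P (+ n ℤ.- + 2 ℤ.* + w)) w≡w₁) (vanish₁ (+ n) (+ w₁) (+ w₂))
      where
      vanish₁ : ∀ N A B → ((N ℤ.- + 2 ℤ.* A) ℤ.- (N ℤ.- + 2 ℤ.* A)) ℤ.* ((N ℤ.- + 2 ℤ.* A) ℤ.- (N ℤ.- + 2 ℤ.* B)) ≡ + 0
      vanish₁ = ℤ-Solver.solve-∀
    atWeight (inj₂ w≡w₂) = trans (cong (λ w → P (+ n ℤ.- + 2 ℤ.* + w)) w≡w₂) (vanish₂ (+ n) (+ w₁) (+ w₂))
      where
      vanish₂ : ∀ N A B → ((N ℤ.- + 2 ℤ.* B) ℤ.- (N ℤ.- + 2 ℤ.* A)) ℤ.* ((N ℤ.- + 2 ℤ.* B) ℤ.- (N ℤ.- + 2 ℤ.* B)) ≡ + 0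
      vanish₂ = ℤ-Solver.solve-∀

  ∑ᶜ-σ-*-P : ∀ v → ℤᶜ.∑ᶜ k (λ m → σ (dot m v) ℤ.* P (bias m)) ≡ + 4 ℤ.* + w₁ ℤ.* + w₂
  ∑ᶜ-σ-*-P v = begin
    ℤᶜ.∑ᶜ k (λ m → σ (dot m v) ℤ.* P (bias m))      ≡⟨ ℤᶜ.∑ᶜ-pointMass₀ k _ (λ m m≢0 →
                                                         trans (cong (σ (dot m v) ℤ.*_) (P-bias-nonzero m≢0)) (ℤₚ.*-zeroʳ (σ (dot m v)))) ⟩
    σ (dot (zeroVec k) v) ℤ.* P (bias (zeroVec k))  ≡⟨ cong₂ (λ b p → σ b ℤ.* p) (dot-zeroˡ v) P-bias-zero ⟩
    + 1 ℤ.* (+ 4 ℤ.* + w₁ ℤ.* + w₂)                 ≡⟨ ℤₚ.*-identityˡ _ ⟩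
    + 4 ℤ.* + w₁ ℤ.* + w₂                           ∎
    where open ≡-Reasoning

  slope offset : ℤ
  slope  = ℤ.- (shift₁ ℤ.+ shift₂)
  offset = shift₁ ℤ.* shift₂

  twoWeightIdentity : ∀ v → + (2 ^ k) ℤ.* (+ pairs v ℤ.+ slope ℤ.* + mult v ℤ.+ offset ℤ.* + δ₀ v)
                            ≡ + 4 ℤ.* + w₁ ℤ.* + w₂
  twoWeightIdentity v = begin
    N ℤ.* (+ pairs v ℤ.+ slope ℤ.* + mult v ℤ.+ offset ℤ.* + δ₀ v)
      ≡⟨ distribute N (+ pairs v) slope (+ mult v) offset (+ δ₀ v) ⟩
    N ℤ.* + pairs v ℤ.+ slope ℤ.* (N ℤ.* + mult v) ℤ.+ offset ℤ.* (N ℤ.* + δ₀ v)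
      ≡⟨ cong₂ ℤ._+_ (cong₂ (λ a b → a ℤ.+ slope ℤ.* b) (ℤₚ.pos-* (2 ^ k) _) (ℤₚ.pos-* (2 ^ k) _))
                     (cong (offset ℤ.*_) (ℤₚ.pos-* (2 ^ k) _)) ⟨
    + (2 ^ k * pairs v) ℤ.+ slope ℤ.* + (2 ^ k * mult v) ℤ.+ offset ℤ.* + (2 ^ k * δ₀ v)
      ≡⟨ cong₂ ℤ._+_ (cong₂ (λ a b → a ℤ.+ slope ℤ.* b) (secondMoment v) (firstMoment v))
                     (cong (offset ℤ.*_) (∑ᶜ-σ-dot k v)) ⟨
    Σ (λ m → χ m ℤ.* (bias m ℤ.* bias m)) ℤ.+ slope ℤ.* Σ (λ m → χ m ℤ.* bias m) ℤ.+ offset ℤ.* Σ χ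
      ≡⟨ cong₂ ℤ._+_ (cong (ℤ._+_ (Σ (λ m → χ m ℤ.* (bias m ℤ.* bias m)))) (ℤᶜ.*-distribˡ-∑ᶜ k slope _))
                     (ℤᶜ.*-distribˡ-∑ᶜ k offset χ) ⟩
    Σ (λ m → χ m ℤ.* (bias m ℤ.* bias m)) ℤ.+ Σ (λ m → slope ℤ.* (χ m ℤ.* bias m)) ℤ.+ Σ (λ m → offset ℤ.* χ m)
      ≡⟨ trans (ℤᶜ.∑ᶜ-distrib-+ k _ _) (cong (ℤ._+ Σ (λ m → offset ℤ.* χ m)) (ℤᶜ.∑ᶜ-distrib-+ k _ _)) ⟨
    Σ (λ m → χ m ℤ.* (bias m ℤ.* bias m) ℤ.+ slope ℤ.* (χ m ℤ.* bias m) ℤ.+ offset ℤ.* χ m)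
      ≡⟨ ℤᶜ.∑ᶜ-cong k (λ m → expand (χ m) (bias m) shift₁ shift₂) ⟨
    Σ (λ m → χ m ℤ.* P (bias m))
      ≡⟨ ∑ᶜ-σ-*-P v ⟩
    + 4 ℤ.* + w₁ ℤ.* + w₂ ∎
    where
    open ≡-Reasoning
    N : ℤ
    N = + (2 ^ k)
    Σ : (Vec Bool k → ℤ) → ℤ
    Σ = ℤᶜ.∑ᶜ k
    χ : Vec Bool k → ℤ
    χ m = σ (dot m v)
    distribute : ∀ n p s c o d → n ℤ.* (p ℤ.+ s ℤ.* c ℤ.+ o ℤ.* d) ≡ n ℤ.* p ℤ.+ s ℤ.* (n ℤ.* c) ℤ.+ o ℤ.* (n ℤ.* d)
    distribute = ℤ-Solver.solve-∀
    expand : ∀ s x a b → s ℤ.* ((x ℤ.- a) ℤ.* (x ℤ.- b))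
                         ≡ s ℤ.* (x ℤ.* x) ℤ.+ ℤ.- (a ℤ.+ b) ℤ.* (s ℤ.* x) ℤ.+ a ℤ.* b ℤ.* s
    expand = ℤ-Solver.solve-∀

  identityAt : ∀ {v p c d} → pairs v ≡ p → mult v ≡ c → δ₀ v ≡ d →
               + (2 ^ k) ℤ.* (+ p ℤ.+ slope ℤ.* + c ℤ.+ offset ℤ.* + d) ≡ + 4 ℤ.* + w₁ ℤ.* + w₂
  identityAt {v} refl refl refl = twoWeightIdentity v

  originIdentity : (∀ j → col G j ≢ zeroVec k) →
                   + (2 ^ k) ℤ.* (+ (n + excess) ℤ.+ offset) ≡ + 4 ℤ.* + w₁ ℤ.* + w₂
  originIdentity col≢0 =
    trans (cong (+ (2 ^ k) ℤ.*_) (simplify (+ (n + excess)) slope offset))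
          (identityAt {zeroVec k} pairs-zero (mult-zero col≢0) (δ₀-zero k))
    where
    simplify : ∀ p s o → p ℤ.+ o ≡ p ℤ.+ s ℤ.* + 0 ℤ.+ o ℤ.* + 1
    simplify = ℤ-Solver.solve-∀

  shellIdentity : n ≤ w₁ + w₂ → ∀ {v} → v ≢ zeroVec k →
                  2 ^ k * (pairs v + (2 * (w₁ + w₂) ∸ 2 * n) * mult v) ≡ 4 * w₁ * w₂
  shellIdentity n≤w₁+w₂ {v} v≢0 = ℤₚ.+-injective (begin
    + (2 ^ k * (pairs v + a * mult v))                          ≡⟨ ℤₚ.pos-* (2 ^ k) _ ⟩
    + (2 ^ k) ℤ.* + (pairs v + a * mult v)                      ≡⟨ cong (+ (2 ^ k) ℤ.*_) (ℤₚ.pos-+ (pairs v) _) ⟩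
    + (2 ^ k) ℤ.* (+ pairs v ℤ.+ + (a * mult v))                ≡⟨ cong (λ t → + (2 ^ k) ℤ.* (+ pairs v ℤ.+ t)) (ℤₚ.pos-* a _) ⟩
    + (2 ^ k) ℤ.* (+ pairs v ℤ.+ + a ℤ.* + mult v)              ≡⟨ cong (λ s → + (2 ^ k) ℤ.* (+ pairs v ℤ.+ s ℤ.* + mult v)) slope≡a ⟨
    + (2 ^ k) ℤ.* (+ pairs v ℤ.+ slope ℤ.* + mult v)            ≡⟨ cong (+ (2 ^ k) ℤ.*_) (dropLast (+ pairs v) slope (+ mult v) offset) ⟩
    + (2 ^ k) ℤ.* (+ pairs v ℤ.+ slope ℤ.* + mult v ℤ.+ offset ℤ.* + 0)  ≡⟨ identityAt {v} refl refl (δ₀-nonzero v≢0) ⟩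
    + 4 ℤ.* + w₁ ℤ.* + w₂                                       ≡⟨ cong (ℤ._* + w₂) (ℤₚ.pos-* 4 w₁) ⟨
    + (4 * w₁) ℤ.* + w₂                                         ≡⟨ ℤₚ.pos-* (4 * w₁) w₂ ⟨
    + (4 * w₁ * w₂)                                             ∎)
    where
    open ≡-Reasoning
    a : ℕ
    a = 2 * (w₁ + w₂) ∸ 2 * n
    dropLast : ∀ p s c o → p ℤ.+ s ℤ.* c ≡ p ℤ.+ s ℤ.* c ℤ.+ o ℤ.* + 0
    dropLast = ℤ-Solver.solve-∀
    regroup : ∀ N A B → ℤ.- ((N ℤ.- + 2 ℤ.* A) ℤ.+ (N ℤ.- + 2 ℤ.* B)) ≡ + 2 ℤ.* (A ℤ.+ B) ℤ.- + 2 ℤ.* N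
    regroup = ℤ-Solver.solve-∀
    slope≡a : slope ≡ + a
    slope≡a = begin
      slope                                            ≡⟨ regroup (+ n) (+ w₁) (+ w₂) ⟩
      + 2 ℤ.* (+ w₁ ℤ.+ + w₂) ℤ.- + 2 ℤ.* + n          ≡⟨ cong₂ (λ x y → + 2 ℤ.* x ℤ.- y) (ℤₚ.pos-+ w₁ w₂) (ℤₚ.pos-* 2 n) ⟨
      + 2 ℤ.* + (w₁ + w₂) ℤ.- + (2 * n)                ≡⟨ cong (ℤ._- + (2 * n)) (ℤₚ.pos-* 2 (w₁ + w₂)) ⟨
      + (2 * (w₁ + w₂)) ℤ.- + (2 * n)                  ≡⟨ ℤₚ.m-n≡m⊖n (2 * (w₁ + w₂)) (2 * n) ⟩
      2 * (w₁ + w₂) ℤ.⊖ 2 * n                          ≡⟨ ℤₚ.⊖-≥ (ℕₚ.*-monoʳ-≤ 2 n≤w₁+w₂) ⟩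
      + a                                              ∎

module Length53 {n k : ℕ} (G : Generator n k) (col≢0 : ∀ j → col G j ≢ zeroVec k)
  (length≡53 : n ≡ 53) (size≡256 : 2 ^ k ≡ 256) (excess≡14 : Columns.excess G ≡ 14)
  (shell : ∀ {v} → v ≢ zeroVec k → Columns.pairs G v + 6 * Columns.mult G v ≡ 12) where

  open Columns G

  mult≤2 : ∀ v → mult v ≤ 2
  mult≤2 v with v ≟ᵛ zeroVec k
  ... | yes refl = subst (_≤ 2) (sym (mult-zero col≢0)) z≤n
  ... | no  v≢0  = ℕₚ.*-cancelˡ-≤ 6 (subst (6 * mult v ≤_) (shell v≢0) (ℕₚ.m≤n+m (6 * mult v) (pairs v)))

  byMultiplicity : (P : ℕ → Set) → P 0 → P 1 → P 2 → ∀ v → P (mult v)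
  byMultiplicity P p₀ p₁ p₂ v with mult v | mult≤2 v
  ... | 0 | _ = p₀
  ... | 1 | _ = p₁
  ... | 2 | _ = p₂
  ... | suc (suc (suc _)) | s≤s (s≤s ())

  inSupport doubled : Vec Bool k → ℕ
  inSupport v = mult v ⊓ 1
  doubled   v = mult v ∸ 1

  mult≡inSupport+doubled : ∀ v → mult v ≡ inSupport v + doubled v
  mult≡inSupport+doubled = byMultiplicity (λ m → m ≡ m ⊓ 1 + (m ∸ 1)) refl refl refl

  mult²≡inSupport+3doubled : ∀ v → mult v * mult v ≡ inSupport v + 3 * doubled v
  mult²≡inSupport+3doubled = byMultiplicity (λ m → m * m ≡ m ⊓ 1 + 3 * (m ∸ 1)) refl refl refl

  inSupport-idem : ∀ v → inSupport v * inSupport v ≡ inSupport v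
  inSupport-idem = byMultiplicity (λ m → (m ⊓ 1) * (m ⊓ 1) ≡ m ⊓ 1) refl refl refl

  ∑ᶜ-mult : ∑ᶜ k mult ≡ 53
  ∑ᶜ-mult = begin
    ∑ᶜ k mult                   ≡⟨ ∑ᶜ-cong k (λ v → ℕₚ.*-identityˡ (mult v)) ⟨
    ∑ᶜ k (λ v → 1 * mult v)     ≡⟨ ∑ᶜ-*-mult (λ _ → 1) ⟩
    ∑[ j < n ] 1                ≡⟨ ∑-const n 1 ⟩
    n * 1                       ≡⟨ ℕₚ.*-identityʳ n ⟩
    n                           ≡⟨ length≡53 ⟩
    53                          ∎
    where open ≡-Reasoning

  ∑ᶜ-mult² : ∑ᶜ k (λ v → mult v * mult v) ≡ 67
  ∑ᶜ-mult² = trans (∑ᶜ-*-mult mult) (trans ∑-mult-col (cong₂ _+_ length≡53 excess≡14))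

  ∑ᶜ-doubled : ∑ᶜ k doubled ≡ 7
  ∑ᶜ-doubled = ℕₚ.*-cancelˡ-≡ _ 7 2 (ℕₚ.+-cancelˡ-≡ 53 _ _ (begin
    53 + 2 * ∑ᶜ k doubled                      ≡⟨ cong (_+ 2 * ∑ᶜ k doubled) (trans (sym ∑ᶜ-mult) (∑ᶜ-split₁)) ⟩
    (∑ᶜ k inSupport + ∑ᶜ k doubled) + 2 * ∑ᶜ k doubled   ≡⟨ regroup (∑ᶜ k inSupport) (∑ᶜ k doubled) ⟩
    ∑ᶜ k inSupport + 3 * ∑ᶜ k doubled          ≡⟨ ∑ᶜ-split₂ ⟨
    67                                         ∎))
    where
    open ≡-Reasoning
    regroup : ∀ a b → (a + b) + 2 * b ≡ a + 3 * b
    regroup = solve-∀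
    ∑ᶜ-split₁ : ∑ᶜ k mult ≡ ∑ᶜ k inSupport + ∑ᶜ k doubled
    ∑ᶜ-split₁ = trans (∑ᶜ-cong k mult≡inSupport+doubled) (∑ᶜ-distrib-+ k inSupport doubled)
    ∑ᶜ-split₂ : 67 ≡ ∑ᶜ k inSupport + 3 * ∑ᶜ k doubled
    ∑ᶜ-split₂ = begin
      67                                                  ≡⟨ ∑ᶜ-mult² ⟨
      ∑ᶜ k (λ v → mult v * mult v)                        ≡⟨ ∑ᶜ-cong k mult²≡inSupport+3doubled ⟩
      ∑ᶜ k (λ v → inSupport v + 3 * doubled v)            ≡⟨ ∑ᶜ-distrib-+ k inSupport _ ⟩
      ∑ᶜ k inSupport + ∑ᶜ k (λ v → 3 * doubled v)         ≡⟨ cong (_+_ (∑ᶜ k inSupport)) (*-distribˡ-∑ᶜ k 3 doubled) ⟨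
      ∑ᶜ k inSupport + 3 * ∑ᶜ k doubled                   ∎

  ∑ᶜ-inSupport : ∑ᶜ k inSupport ≡ 46
  ∑ᶜ-inSupport = ℕₚ.+-cancelʳ-≡ 7 _ 46 (begin
    ∑ᶜ k inSupport + 7               ≡⟨ cong (_+_ (∑ᶜ k inSupport)) ∑ᶜ-doubled ⟨
    ∑ᶜ k inSupport + ∑ᶜ k doubled    ≡⟨ ∑ᶜ-distrib-+ k inSupport doubled ⟨
    ∑ᶜ k (λ v → inSupport v + doubled v)  ≡⟨ ∑ᶜ-cong k mult≡inSupport+doubled ⟨
    ∑ᶜ k mult                        ≡⟨ ∑ᶜ-mult ⟩
    53                               ∎)
    where open ≡-Reasoning

  doubled-cases : ∀ u → (doubled u ≡ 0) ⊎ (mult u ≡ 2)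
  doubled-cases = byMultiplicity (λ m → (m ∸ 1 ≡ 0) ⊎ (m ≡ 2)) (inj₁ refl) (inj₁ refl) (inj₂ refl)

  doubled≡1 : ∀ u → mult u ≡ 2 → doubled u ≡ 1
  doubled≡1 u mult≡2 = cong (_∸ 1) mult≡2

  inSupport≤mult : ∀ v → inSupport v ≤ mult v
  inSupport≤mult = byMultiplicity (λ m → m ⊓ 1 ≤ m) z≤n (s≤s z≤n) (s≤s z≤n)

  -- The pair count of a doubled value is 12 − 6·2 = 0.
  doubled⇒sumFree : ∀ u → mult u ≡ 2 → ∀ a → mult (u ⊕ a) * mult a ≡ 0
  doubled⇒sumFree u mult≡2 a = ℕₚ.n≤0⇒n≡0 (begin
    mult (u ⊕ a) * mult a                   ≤⟨ term≤∑ᶜ k (λ b → mult (u ⊕ b) * mult b) a ⟩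
    ∑ᶜ k (λ b → mult (u ⊕ b) * mult b)      ≡⟨ pairs≡∑ᶜ u ⟨
    pairs u                                 ≡⟨ ℕₚ.+-cancelʳ-≡ 12 (pairs u) 0
                                                 (trans (cong (λ m → pairs u + 6 * m) (sym mult≡2)) (shell u≢0)) ⟩
    0                                       ∎)
    where
    open ℕₚ.≤-Reasoning
    u≢0 : u ≢ zeroVec k
    u≢0 u≡0 = contradiction (trans (sym (mult-zero col≢0)) (trans (cong mult (sym u≡0)) mult≡2)) λ ()

  common : Vec Bool k → Vec Bool k → ℕ
  common u w = ∑ᶜ k (λ z → inSupport (z ⊕ u) * inSupport (z ⊕ w))

  common-self : ∀ u → common u u ≡ 46
  common-self u = trans (∑ᶜ-cong k (λ z → inSupport-idem (z ⊕ u)))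
                        (trans (∑ᶜ-translate k inSupport u) ∑ᶜ-inSupport)

  -- Beyond the translates counted by common u w, pairs (u ⊕ w) counts (u, w) and (w, u) with weight 2·2 each.
  common-≤ : ∀ {u w} → mult u ≡ 2 → mult w ≡ 2 → u ≢ w → common u w ≤ 6
  common-≤ {u} {w} mult-u≡2 mult-w≡2 u≢w = ℕₚ.+-cancelʳ-≤ 6 (common u w) 6 (begin
    common u w + 6                          ≡⟨ cong₂ _+_ common≡ (sym (cong₂ _+_ excessAt-u excessAt-w)) ⟩
    ∑ᶜ k f + (g u + g w)                    ≤⟨ ℕₚ.+-monoʳ-≤ (∑ᶜ k f) (twoTerms≤∑ᶜ k g u≢w) ⟩
    ∑ᶜ k f + ∑ᶜ k g                         ≡⟨ ∑ᶜ-distrib-+ k f g ⟨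
    ∑ᶜ k (λ a → f a + g a)                  ≡⟨ ∑ᶜ-cong k (λ a → ℕₚ.m+[n∸m]≡n (inSupport≤ a)) ⟩
    ∑ᶜ k (λ a → mult (v ⊕ a) * mult a)      ≡⟨ pairs≡∑ᶜ v ⟨
    pairs v                                 ≤⟨ ℕₚ.m≤m+n (pairs v) (6 * mult v) ⟩
    pairs v + 6 * mult v                    ≡⟨ shell (u≢w ∘ ⊕≡zero⇒≡) ⟩
    12                                      ∎)
    where
    open ℕₚ.≤-Reasoning
    v : Vec Bool k
    v = u ⊕ w
    f g : Vec Bool k → ℕ
    f a = inSupport (v ⊕ a) * inSupport a
    g a = mult (v ⊕ a) * mult a ∸ f a
    inSupport≤ : ∀ a → f a ≤ mult (v ⊕ a) * mult a
    inSupport≤ a = ℕₚ.*-mono-≤ (inSupport≤mult (v ⊕ a)) (inSupport≤mult a)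
    common≡ : common u w ≡ ∑ᶜ k f
    common≡ = trans (∑ᶜ-cong k (λ z → trans (ℕₚ.*-comm (inSupport (z ⊕ u)) _)
                                            (cong (λ t → inSupport t * inSupport (z ⊕ u)) (sym (⊕-translate u w z)))))
                    (∑ᶜ-translate k f u)
    excessAt-u : g u ≡ 3
    excessAt-u rewrite ⊕-cancelˡ u w | mult-u≡2 | mult-w≡2 = refl
    excessAt-w : g w ≡ 3
    excessAt-w rewrite ⊕-cancelʳ u w | mult-u≡2 | mult-w≡2 = refl

  hits : Vec Bool k → ℕ
  hits z = ∑ᶜ k (λ u → doubled u * inSupport (z ⊕ u))

  ∑ᶜ-translates : ∀ u → ∑ᶜ k (λ z → inSupport (z ⊕ u)) ≡ 46
  ∑ᶜ-translates u = trans (∑ᶜ-translate k inSupport u) ∑ᶜ-inSupport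

  ∑ᶜ-hits : ∑ᶜ k hits ≡ 322
  ∑ᶜ-hits = begin
    ∑ᶜ k hits                                                  ≡⟨ ∑ᶜ-comm k k _ ⟩
    ∑ᶜ k (λ u → ∑ᶜ k (λ z → doubled u * inSupport (z ⊕ u)))    ≡⟨ ∑ᶜ-cong k (λ u → *-distribˡ-∑ᶜ k (doubled u) _) ⟨
    ∑ᶜ k (λ u → doubled u * ∑ᶜ k (λ z → inSupport (z ⊕ u)))    ≡⟨ ∑ᶜ-cong k (λ u → trans (cong (doubled u *_) (∑ᶜ-translates u))
                                                                                          (ℕₚ.*-comm (doubled u) 46)) ⟩
    ∑ᶜ k (λ u → 46 * doubled u)                                ≡⟨ *-distribˡ-∑ᶜ k 46 doubled ⟨
    46 * ∑ᶜ k doubled                                          ≡⟨ cong (46 *_) ∑ᶜ-doubled ⟩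
    322                                                        ∎
    where open ≡-Reasoning

  ∑ᶜ-*-∑ᶜ : ∀ (f g : Vec Bool k → ℕ) → ∑ᶜ k f * ∑ᶜ k g ≡ ∑ᶜ k (λ u → ∑ᶜ k (λ w → f u * g w))
  ∑ᶜ-*-∑ᶜ f g = begin
    ∑ᶜ k f * ∑ᶜ k g                        ≡⟨ ℕₚ.*-comm (∑ᶜ k f) _ ⟩
    ∑ᶜ k g * ∑ᶜ k f                        ≡⟨ *-distribˡ-∑ᶜ k (∑ᶜ k g) f ⟩
    ∑ᶜ k (λ u → ∑ᶜ k g * f u)              ≡⟨ ∑ᶜ-cong k (λ u → trans (ℕₚ.*-comm _ (f u)) (*-distribˡ-∑ᶜ k (f u) g)) ⟩
    ∑ᶜ k (λ u → ∑ᶜ k (λ w → f u * g w))    ∎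
    where open ≡-Reasoning

  ∑ᶜ-hits² : ∑ᶜ k (λ z → hits z * hits z) ≡ ∑ᶜ k (λ u → ∑ᶜ k (λ w → (doubled u * doubled w) * common u w))
  ∑ᶜ-hits² = begin
    ∑ᶜ k (λ z → hits z * hits z)
      ≡⟨ ∑ᶜ-cong k (λ z → trans (∑ᶜ-*-∑ᶜ _ _)
                                 (∑ᶜ-cong k (λ u → ∑ᶜ-cong k (λ w → interchange (doubled u) _ (doubled w) _)))) ⟩
    ∑ᶜ k (λ z → ∑ᶜ k (λ u → ∑ᶜ k (λ w → (doubled u * doubled w) * (inSupport (z ⊕ u) * inSupport (z ⊕ w)))))
      ≡⟨ trans (∑ᶜ-comm k k _) (∑ᶜ-cong k (λ u → ∑ᶜ-comm k k _)) ⟩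
    ∑ᶜ k (λ u → ∑ᶜ k (λ w → ∑ᶜ k (λ z → (doubled u * doubled w) * (inSupport (z ⊕ u) * inSupport (z ⊕ w)))))
      ≡⟨ ∑ᶜ-cong k (λ u → ∑ᶜ-cong k (λ w → *-distribˡ-∑ᶜ k (doubled u * doubled w) _)) ⟨
    ∑ᶜ k (λ u → ∑ᶜ k (λ w → (doubled u * doubled w) * common u w))
      ∎
    where
    open ≡-Reasoning
    interchange : ∀ a b c d → (a * b) * (c * d) ≡ (a * c) * (b * d)
    interchange = solve-∀

  ∑ᶜ-δ₀-⊕ : ∀ u → ∑ᶜ k (λ w → δ₀ (u ⊕ w)) ≡ 1
  ∑ᶜ-δ₀-⊕ u = trans (∑ᶜ-pointMass k _ u (λ w w≢u → δ₀-⊕-≢ (w≢u ∘ sym))) (δ₀-⊕-self u)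

  common-bound : ∀ u w → (doubled u * doubled w) * common u w ≤ 6 * (doubled u * doubled w) + 40 * (doubled u * δ₀ (u ⊕ w))
  common-bound u w with doubled-cases u | doubled-cases w
  ... | inj₁ du≡0 | _ rewrite du≡0 = z≤n
  ... | inj₂ _ | inj₁ dw≡0 rewrite dw≡0 | ℕₚ.*-zeroʳ (doubled u) = z≤n
  ... | inj₂ mult-u≡2 | inj₂ mult-w≡2 = begin
    (doubled u * doubled w) * common u w      ≡⟨ cong₂ (λ a b → (a * b) * common u w) du≡1 dw≡1 ⟩
    1 * common u w                            ≡⟨ ℕₚ.*-identityˡ (common u w) ⟩
    common u w                                ≤⟨ bothDoubled ⟩
    6 + 40 * δ₀ (u ⊕ w)                       ≡⟨ cong (λ d → 6 + 40 * d) (ℕₚ.*-identityˡ (δ₀ (u ⊕ w))) ⟨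
    6 * (1 * 1) + 40 * (1 * δ₀ (u ⊕ w))       ≡⟨ cong₂ (λ a b → 6 * (a * b) + 40 * (a * δ₀ (u ⊕ w))) du≡1 dw≡1 ⟨
    6 * (doubled u * doubled w) + 40 * (doubled u * δ₀ (u ⊕ w)) ∎
    where
    open ℕₚ.≤-Reasoning
    du≡1 : doubled u ≡ 1
    du≡1 = doubled≡1 u mult-u≡2
    dw≡1 : doubled w ≡ 1
    dw≡1 = doubled≡1 w mult-w≡2
    bothDoubled : common u w ≤ 6 + 40 * δ₀ (u ⊕ w)
    bothDoubled with u ≟ᵛ w
    ... | yes refl = ℕₚ.≤-reflexive (trans (common-self u) (cong (λ d → 6 + 40 * d) (sym (δ₀-⊕-self u))))
    ... | no  u≢w  = ℕₚ.≤-trans (common-≤ mult-u≡2 mult-w≡2 u≢w) (ℕₚ.m≤m+n 6 _)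

  ∑ᶜ-hits²≤ : ∑ᶜ k (λ z → hits z * hits z) ≤ 574
  ∑ᶜ-hits²≤ = begin
    ∑ᶜ k (λ z → hits z * hits z)
      ≡⟨ ∑ᶜ-hits² ⟩
    ∑ᶜ k (λ u → ∑ᶜ k (λ w → (doubled u * doubled w) * common u w))
      ≤⟨ ∑ᶜ-mono-≤ k (λ u → ∑ᶜ-mono-≤ k (common-bound u)) ⟩
    ∑ᶜ k (λ u → ∑ᶜ k (λ w → 6 * (doubled u * doubled w) + 40 * (doubled u * δ₀ (u ⊕ w))))
      ≡⟨ ∑ᶜ-cong k (λ u → row u) ⟩
    ∑ᶜ k (λ u → 82 * doubled u)
      ≡⟨ *-distribˡ-∑ᶜ k 82 doubled ⟨
    82 * ∑ᶜ k doubled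
      ≡⟨ cong (82 *_) ∑ᶜ-doubled ⟩
    574 ∎
    where
    open ℕₚ.≤-Reasoning
    row : ∀ u → ∑ᶜ k (λ w → 6 * (doubled u * doubled w) + 40 * (doubled u * δ₀ (u ⊕ w))) ≡ 82 * doubled u
    row u = begin-equality
      ∑ᶜ k (λ w → 6 * (doubled u * doubled w) + 40 * (doubled u * δ₀ (u ⊕ w)))
        ≡⟨ ∑ᶜ-distrib-+ k _ _ ⟩
      ∑ᶜ k (λ w → 6 * (doubled u * doubled w)) + ∑ᶜ k (λ w → 40 * (doubled u * δ₀ (u ⊕ w)))
        ≡⟨ cong₂ _+_ (trans (cong (6 *_) (*-distribˡ-∑ᶜ k (doubled u) doubled)) (*-distribˡ-∑ᶜ k 6 _))
                     (trans (cong (40 *_) (*-distribˡ-∑ᶜ k (doubled u) _)) (*-distribˡ-∑ᶜ k 40 _)) ⟨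
      6 * (doubled u * ∑ᶜ k doubled) + 40 * (doubled u * ∑ᶜ k (λ w → δ₀ (u ⊕ w)))
        ≡⟨ cong₂ (λ a b → 6 * (doubled u * a) + 40 * (doubled u * b)) ∑ᶜ-doubled (∑ᶜ-δ₀-⊕ u) ⟩
      6 * (doubled u * 7) + 40 * (doubled u * 1)
        ≡⟨ collect (doubled u) ⟩
      82 * doubled u ∎
      where
      collect : ∀ d → 6 * (d * 7) + 40 * (d * 1) ≡ 82 * d
      collect = solve-∀

  hits-zero : hits (zeroVec k) ≡ 7
  hits-zero = trans (∑ᶜ-cong k λ u → trans (cong (λ t → doubled u * inSupport t) (⊕-identityˡ u)) (doubled-inSupport u))
                    ∑ᶜ-doubled
    where
    doubled-inSupport : ∀ u → doubled u * inSupport u ≡ doubled u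
    doubled-inSupport = byMultiplicity (λ m → (m ∸ 1) * (m ⊓ 1) ≡ m ∸ 1) refl refl refl

  hits-support : ∀ z → 1 ≤ mult z → hits z ≡ 0
  hits-support z z∈supp = trans (∑ᶜ-cong k term≡0) (∑ᶜ-zero k)
    where
    outside : ∀ u → mult u ≡ 2 → mult (z ⊕ u) ≡ 0
    outside u mult≡2 = [ trans (cong mult (⊕-comm z u)) , (λ mult-z≡0 → contradiction (subst (1 ≤_) mult-z≡0 z∈supp) λ ()) ]′
                         (ℕₚ.m*n≡0⇒m≡0∨n≡0 (mult (u ⊕ z)) (doubled⇒sumFree u mult≡2 z))
    term≡0 : ∀ u → doubled u * inSupport (z ⊕ u) ≡ 0
    term≡0 u = [ cong (_* inSupport (z ⊕ u))
               , (λ mult≡2 → trans (cong (λ m → doubled u * (m ⊓ 1)) (outside u mult≡2)) (ℕₚ.*-zeroʳ (doubled u))) ]′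
               (doubled-cases u)

  3n≤n²+2 : ∀ r → 3 * r ≤ r * r + 2
  3n≤n²+2 0 = z≤n
  3n≤n²+2 1 = ℕₚ.≤-refl
  3n≤n²+2 2 = ℕₚ.≤-refl
  3n≤n²+2 r@(suc (suc (suc _))) = ℕₚ.≤-trans (ℕₚ.*-monoˡ-≤ r {3} {r} (s≤s (s≤s (s≤s z≤n)))) (ℕₚ.m≤m+n (r * r) 2)

  -- (hits z - 1)(hits z - 2) ≥ 0 off the support; the origin and the support are checked directly.
  pointwise : ∀ z → 3 * hits z + 30 * δ₀ z ≤ hits z * hits z + 2 * (1 ∸ inSupport z)
  pointwise z with z ≟ᵛ zeroVec k
  ... | yes refl rewrite hits-zero | δ₀-zero k | mult-zero col≢0 = ℕₚ.≤-refl
  ... | no  z≢0  rewrite δ₀-nonzero z≢0 | ℕₚ.+-identityʳ (3 * hits z) with mult z in mult≡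
  ...   | zero  = 3n≤n²+2 (hits z)
  ...   | suc _ = ℕₚ.≤-trans (ℕₚ.≤-reflexive (cong (3 *_) (hits-support z (subst (1 ≤_) (sym mult≡) (s≤s z≤n))))) z≤n

  ∑ᶜ-outside : ∑ᶜ k (λ z → 1 ∸ inSupport z) ≡ 210
  ∑ᶜ-outside = ℕₚ.+-cancelˡ-≡ 46 _ 210 (begin
    46 + ∑ᶜ k (λ z → 1 ∸ inSupport z)                   ≡⟨ cong (_+ ∑ᶜ k (λ z → 1 ∸ inSupport z)) ∑ᶜ-inSupport ⟨
    ∑ᶜ k inSupport + ∑ᶜ k (λ z → 1 ∸ inSupport z)       ≡⟨ ∑ᶜ-distrib-+ k inSupport _ ⟨
    ∑ᶜ k (λ z → inSupport z + (1 ∸ inSupport z))        ≡⟨ ∑ᶜ-cong k (λ z → ℕₚ.m+[n∸m]≡n (ℕₚ.m⊓n≤n (mult z) 1)) ⟩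
    ∑ᶜ k (λ _ → 1)                                      ≡⟨ ∑ᶜ-const k 1 ⟩
    2 ^ k * 1                                           ≡⟨ cong (_* 1) size≡256 ⟩
    256                                                 ∎)
    where open ≡-Reasoning

  impossible : ⊥
  impossible = ℕₚ.<⇒≱ (ℕₚ.≤ᵇ⇒≤ 995 996 _) (begin
    996                                                                ≡⟨ weighted ⟨
    ∑ᶜ k (λ z → 3 * hits z + 30 * δ₀ z)                                ≤⟨ ∑ᶜ-mono-≤ k pointwise ⟩
    ∑ᶜ k (λ z → hits z * hits z + 2 * (1 ∸ inSupport z))               ≡⟨ ∑ᶜ-distrib-+ k _ _ ⟩
    ∑ᶜ k (λ z → hits z * hits z) + ∑ᶜ k (λ z → 2 * (1 ∸ inSupport z))  ≡⟨ cong (_+_ (∑ᶜ k (λ z → hits z * hits z)))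
                                                                              (trans (sym (*-distribˡ-∑ᶜ k 2 _)) (cong (2 *_) ∑ᶜ-outside)) ⟩
    ∑ᶜ k (λ z → hits z * hits z) + 420                                 ≤⟨ ℕₚ.+-monoˡ-≤ 420 ∑ᶜ-hits²≤ ⟩
    994                                                                ∎)
    where
    open ℕₚ.≤-Reasoning
    ∑ᶜ-δ₀ : ∑ᶜ k δ₀ ≡ 1
    ∑ᶜ-δ₀ = trans (∑ᶜ-pointMass₀ k δ₀ (λ v v≢0 → δ₀-nonzero v≢0)) (δ₀-zero k)
    weighted : ∑ᶜ k (λ z → 3 * hits z + 30 * δ₀ z) ≡ 996
    weighted = begin-equality
      ∑ᶜ k (λ z → 3 * hits z + 30 * δ₀ z)                  ≡⟨ ∑ᶜ-distrib-+ k _ _ ⟩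
      ∑ᶜ k (λ z → 3 * hits z) + ∑ᶜ k (λ z → 30 * δ₀ z)     ≡⟨ cong₂ _+_ (*-distribˡ-∑ᶜ k 3 hits) (*-distribˡ-∑ᶜ k 30 δ₀) ⟨
      3 * ∑ᶜ k hits + 30 * ∑ᶜ k δ₀                          ≡⟨ cong₂ (λ a b → 3 * a + 30 * b) ∑ᶜ-hits ∑ᶜ-δ₀ ⟩
      996                                                  ∎

decideUpTo56 : {P : ℕ → Set} (P? : ∀ n → Dec (P n)) → {True (Finₚ.all? (λ (i : Fin 57) → P? (toℕ i)))} →
               ∀ n → n ≤ 56 → P n
decideUpTo56 {P} P? {allP} n n≤56 = subst P (Finₚ.toℕ-fromℕ< (s≤s n≤56)) (toWitness allP (fromℕ< (s≤s n≤56)))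

-- The excess forced by n + excess + (n - 48)(n - 64) = y.
excessFor : ℕ → ℕ → ℤ
excessFor y n = + y ℤ.- + n ℤ.- (+ n ℤ.- + 48) ℤ.* (+ n ℤ.- + 64)

excessFor-3 : ∀ n → n ≤ 56 → ¬ (2 ∣ ℤ.∣ excessFor 3 n ∣)
excessFor-3 = decideUpTo56 (λ n → ¬? (2 ∣? ℤ.∣ excessFor 3 n ∣))

excessFor-6 : ∀ n → n ≤ 56 → (excessFor 6 n ℤ.< + 0) ⊎ (n ≤ 54 × excessFor 6 n ≢ + 0) ⊎ (55 ≤ n × excessFor 6 n ≡ + 14)
excessFor-6 = decideUpTo56 λ n →
  (excessFor 6 n ℤ.<? + 0)
  ⊎-dec ((n ℕₚ.≤? 54) ×-dec ¬? (excessFor 6 n ℤₚ.≟ + 0))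
  ⊎-dec ((55 ℕₚ.≤? n) ×-dec (excessFor 6 n ℤₚ.≟ + 14))

excessFor-12 : ∀ n → n ≤ 56 → (excessFor 12 n ℤ.< + 0) ⊎ (n ≡ 51 × excessFor 12 n ≡ + 0) ⊎ (n ≡ 52 × excessFor 12 n ≢ + 0)
                             ⊎ (n ≡ 53 × excessFor 12 n ≡ + 14) ⊎ (54 ≤ n)
excessFor-12 = decideUpTo56 λ n →
  (excessFor 12 n ℤ.<? + 0)
  ⊎-dec ((n ℕₚ.≟ 51) ×-dec (excessFor 12 n ℤₚ.≟ + 0))
  ⊎-dec ((n ℕₚ.≟ 52) ×-dec ¬? (excessFor 12 n ℤₚ.≟ + 0))
  ⊎-dec ((n ℕₚ.≟ 53) ×-dec (excessFor 12 n ℤₚ.≟ + 14))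
  ⊎-dec (54 ℕₚ.≤? n)

length≥54 : ∀ n → n ≤ 56 → 54 ≤ n → (n ≡ 54) ⊎ (n ≡ 55) ⊎ (n ≡ 56)
length≥54 = decideUpTo56 λ n → (54 ℕₚ.≤? n) →-dec ((n ℕₚ.≟ 54) ⊎-dec (n ℕₚ.≟ 55) ⊎-dec (n ℕₚ.≟ 56))

2048*x≢3072 : ∀ x → + 2048 ℤ.* x ≢ + 3072
2048*x≢3072 (+ 0)                 ()
2048*x≢3072 (+ 1)                 ()
2048*x≢3072 (+ suc (suc x)) 2048*x≡3072 = ℕₚ.<⇒≱ (ℕₚ.≤ᵇ⇒≤ 3073 4096 _) (begin
  4096                     ≤⟨ ℕₚ.*-monoʳ-≤ 2048 {2} {suc (suc x)} (s≤s (s≤s z≤n)) ⟩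
  2048 * suc (suc x)       ≡⟨ ℤₚ.+-injective (trans (ℤₚ.pos-* 2048 (suc (suc x))) 2048*x≡3072) ⟩
  3072                     ∎)
  where open ℕₚ.≤-Reasoning
2048*x≢3072 ℤ.-[1+ x ]             ()

2^k*y≡3072-cases : ∀ k {y} → + (2 ^ k) ℤ.* y ≡ + 3072 →
                  (k ≤ 7) ⊎ (k ≡ 8 × y ≡ + 12) ⊎ (k ≡ 9 × y ≡ + 6) ⊎ (k ≡ 10 × y ≡ + 3)
2^k*y≡3072-cases 0  _ = inj₁ z≤n
2^k*y≡3072-cases 1  _ = inj₁ (ℕₚ.≤ᵇ⇒≤ 1 7 _)
2^k*y≡3072-cases 2  _ = inj₁ (ℕₚ.≤ᵇ⇒≤ 2 7 _)
2^k*y≡3072-cases 3  _ = inj₁ (ℕₚ.≤ᵇ⇒≤ 3 7 _)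
2^k*y≡3072-cases 4  _ = inj₁ (ℕₚ.≤ᵇ⇒≤ 4 7 _)
2^k*y≡3072-cases 5  _ = inj₁ (ℕₚ.≤ᵇ⇒≤ 5 7 _)
2^k*y≡3072-cases 6  _ = inj₁ (ℕₚ.≤ᵇ⇒≤ 6 7 _)
2^k*y≡3072-cases 7  _ = inj₁ (ℕₚ.≤ᵇ⇒≤ 7 7 _)
2^k*y≡3072-cases 8  {y} eq = inj₂ (inj₁ (refl , ℤₚ.*-cancelˡ-≡ (+ 256) y (+ 12) eq))
2^k*y≡3072-cases 9  {y} eq = inj₂ (inj₂ (inj₁ (refl , ℤₚ.*-cancelˡ-≡ (+ 512) y (+ 6) eq)))
2^k*y≡3072-cases 10 {y} eq = inj₂ (inj₂ (inj₂ (refl , ℤₚ.*-cancelˡ-≡ (+ 1024) y (+ 3) eq)))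
2^k*y≡3072-cases k@(suc (suc (suc (suc (suc (suc (suc (suc (suc (suc (suc j))))))))))) {y} eq =
  contradiction (begin
    + 2048 ℤ.* (+ (2 ^ j) ℤ.* y)   ≡⟨ ℤₚ.*-assoc (+ 2048) (+ (2 ^ j)) y ⟨
    + 2048 ℤ.* + (2 ^ j) ℤ.* y     ≡⟨ cong (ℤ._* y) (ℤₚ.pos-* 2048 (2 ^ j)) ⟨
    + (2048 * 2 ^ j) ℤ.* y         ≡⟨ cong (λ p → + p ℤ.* y) (ℕₚ.^-distribˡ-+-* 2 11 j) ⟨
    + (2 ^ k) ℤ.* y                ≡⟨ eq ⟩
    + 3072                         ∎) (2048*x≢3072 _)
  where open ≡-Reasoning

pronic≢14 : ∀ m → (m ∸ 1) * m ≢ 14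
pronic≢14 0 ()
pronic≢14 1 ()
pronic≢14 2 ()
pronic≢14 3 ()
pronic≢14 4 ()
pronic≢14 m@(suc (suc (suc (suc (suc _))))) eq = ℕₚ.<⇒≱ (ℕₚ.≤ᵇ⇒≤ 15 20 _) (begin
  4 * 5         ≤⟨ ℕₚ.*-mono-≤ {4} {m ∸ 1} {5} {m} (s≤s (s≤s (s≤s (s≤s z≤n)))) (s≤s (s≤s (s≤s (s≤s (s≤s z≤n))))) ⟩
  (m ∸ 1) * m   ≡⟨ eq ⟩
  14            ∎)
  where open ℕₚ.≤-Reasoning

module Weights24And32 {n k : ℕ} (G : Generator n k) (independent : LinIndep G) (full : FullLength G) (n≤56 : n ≤ 56)
  (weights : ∀ c → c ∈C G → c ≢ zeroVec n → (wt c ≡ 24) ⊎ (wt c ≡ 32)) where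

  open Columns G
  open TwoWeight G independent 24 32 weights

  col≢0 : ∀ j → col G j ≢ zeroVec k
  col≢0 = fullLength⇒col≢zero G full

  originValue : ℤ
  originValue = + (n + excess) ℤ.+ offset

  origin : + (2 ^ k) ℤ.* originValue ≡ + 3072
  origin = originIdentity col≢0

  excess≡excessFor : ∀ {y} → originValue ≡ + y → + excess ≡ excessFor y n
  excess≡excessFor {y} origin≡y = begin
    + excess                                      ≡⟨ isolate (+ n) (+ excess) offset ⟩
    + n ℤ.+ + excess ℤ.+ offset ℤ.- + n ℤ.- offset  ≡⟨ cong (λ t → t ℤ.+ offset ℤ.- + n ℤ.- offset) (ℤₚ.pos-+ n excess) ⟨
    originValue ℤ.- + n ℤ.- offset                  ≡⟨ cong (λ t → t ℤ.- + n ℤ.- offset) origin≡y ⟩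
    excessFor y n                                 ∎
    where
    open ≡-Reasoning
    isolate : ∀ N X O → X ≡ N ℤ.+ X ℤ.+ O ℤ.- N ℤ.- O
    isolate = ℤ-Solver.solve-∀

  excessFor≮0 : ∀ {y} → originValue ≡ + y → ¬ (excessFor y n ℤ.< + 0)
  excessFor≮0 origin≡y neg = ℤₚ.+≮0 (subst (ℤ._< + 0) (sym (excess≡excessFor origin≡y)) neg)

  shell : ∀ {y} → 2 ^ k * y ≡ 3072 → ∀ {v} → v ≢ zeroVec k → pairs v + (112 ∸ 2 * n) * mult v ≡ y
  shell {y} 2ᵏy≡3072 v≢0 = ℕₚ.*-cancelˡ-≡ _ y (2 ^ k) {{ℕₚ.m^n≢0 2 k}} (trans (shellIdentity n≤56 v≢0) (sym 2ᵏy≡3072))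

  multiplicityFree⇒excessFor≡0 : ∀ {y} → originValue ≡ + y → MultiplicityFree → excessFor y n ≡ + 0
  multiplicityFree⇒excessFor≡0 origin≡y free = trans (sym (excess≡excessFor origin≡y)) (cong +_ (multiplicityFree⇒excess≡0 free))

  shell₁₂ : k ≡ 8 → ∀ {v} → v ≢ zeroVec k → pairs v + (112 ∸ 2 * n) * mult v ≡ 12
  shell₁₂ k≡8 = shell (cong (λ d → 2 ^ d * 12) k≡8)

  shell₆ : k ≡ 9 → ∀ {v} → v ≢ zeroVec k → pairs v + (112 ∸ 2 * n) * mult v ≡ 6
  shell₆ k≡9 = shell (cong (λ d → 2 ^ d * 6) k≡9)

  dimension8 : k ≡ 8 → originValue ≡ + 12 → (n ≡ 51 × MultiplicityFree) ⊎ (54 ≤ n)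
  dimension8 k≡8 origin≡12 with excessFor-12 n n≤56
  ... | inj₁ neg = contradiction neg (excessFor≮0 origin≡12)
  ... | inj₂ (inj₁ (n≡51 , ≡0)) =
    inj₁ (n≡51 , excess≡0⇒multiplicityFree (ℤₚ.+-injective (trans (excess≡excessFor origin≡12) ≡0)))
  ... | inj₂ (inj₂ (inj₁ (n≡52 , ≢0))) =
    contradiction (multiplicityFree⇒excessFor≡0 origin≡12
                     (shell⇒multiplicityFree (112 ∸ 2 * n) 12 12<2c col≢0 (shell₁₂ k≡8))) ≢0
    where
    12<2c : 12 < 2 * (112 ∸ 2 * n)
    12<2c = subst (λ m → 12 < 2 * (112 ∸ 2 * m)) (sym n≡52) (ℕₚ.≤ᵇ⇒≤ 13 16 _)
  ... | inj₂ (inj₂ (inj₂ (inj₁ (n≡53 , ≡14)))) =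
    ⊥-elim (Length53.impossible G col≢0 n≡53 (cong (2 ^_) k≡8) (ℤₚ.+-injective (trans (excess≡excessFor origin≡12) ≡14))
                                shell₅₃)
    where
    shell₅₃ : ∀ {v} → v ≢ zeroVec k → pairs v + 6 * mult v ≡ 12
    shell₅₃ {v} v≢0 = subst (λ m → pairs v + (112 ∸ 2 * m) * mult v ≡ 12) n≡53 (shell₁₂ k≡8 v≢0)
  ... | inj₂ (inj₂ (inj₂ (inj₂ 54≤n))) = inj₂ 54≤n

  dimension9 : k ≡ 9 → originValue ≢ + 6
  dimension9 k≡9 origin≡6 with excessFor-6 n n≤56
  ... | inj₁ neg = excessFor≮0 origin≡6 neg
  ... | inj₂ (inj₁ (n≤54 , ≢0)) =
    ≢0 (multiplicityFree⇒excessFor≡0 origin≡6 (shell⇒multiplicityFree (112 ∸ 2 * n) 6 6<2c col≢0 (shell₆ k≡9)))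
    where
    6<2c : 6 < 2 * (112 ∸ 2 * n)
    6<2c = ℕₚ.≤-trans (ℕₚ.≤ᵇ⇒≤ 7 8 _) (ℕₚ.*-monoʳ-≤ 2 (ℕₚ.∸-monoʳ-≤ 112 (ℕₚ.*-monoʳ-≤ 2 n≤54)))
  ... | inj₂ (inj₂ (55≤n , ≡14)) with excess-pronic few
    where
    few : ∀ v → v ≢ zeroVec k → pairs v < 8
    few v v≢0 = s≤s (ℕₚ.≤-trans (ℕₚ.m≤m+n (pairs v) _)
                                (ℕₚ.≤-trans (ℕₚ.≤-reflexive (shell₆ k≡9 v≢0)) (ℕₚ.≤ᵇ⇒≤ 6 7 _)))
  ...   | m , excess≡pronic = pronic≢14 m (trans (sym excess≡pronic) (ℤₚ.+-injective (trans (excess≡excessFor origin≡6) ≡14)))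

  dimension10 : originValue ≢ + 3
  dimension10 origin≡3 with excess-even
  ... | t , excess≡2t = excessFor-3 n n≤56 (subst (λ x → 2 ∣ ℤ.∣ x ∣) 2t≡excessFor (m∣m*n t))
    where
    2t≡excessFor : + (2 * t) ≡ excessFor 3 n
    2t≡excessFor = trans (sym (cong +_ excess≡2t)) (excess≡excessFor origin≡3)

lemma6 : (n k : ℕ) (G : Generator n k) → LinIndep G → FullLength G → n ≤ 56
         → ((c : Vec Bool n) → c ∈C G → c ≢ zeroVec n → (wt c ≡ 24) ⊎ (wt c ≡ 32))
         → (k ≤ 8)
           × (k ≡ 8 → (n ≡ 51) ⊎ ((n ≡ 54) ⊎ ((n ≡ 55) ⊎ (n ≡ 56))))
           × (n ≡ 51 → k ≡ 8 → Projective G)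
lemma6 n k G independent full n≤56 weights = byDimension (2^k*y≡3072-cases k origin)
  where
  open Weights24And32 G independent full n≤56 weights
  byDimension : (k ≤ 7) ⊎ (k ≡ 8 × originValue ≡ + 12) ⊎ (k ≡ 9 × originValue ≡ + 6) ⊎ (k ≡ 10 × originValue ≡ + 3)
                → (k ≤ 8) × (k ≡ 8 → (n ≡ 51) ⊎ (n ≡ 54) ⊎ (n ≡ 55) ⊎ (n ≡ 56)) × (n ≡ 51 → k ≡ 8 → Projective G)
  byDimension (inj₁ k≤7) = ℕₚ.m≤n⇒m≤1+n k≤7 , ⊥-elim ∘ k≢8 , λ _ → ⊥-elim ∘ k≢8
    where
    k≢8 : k ≢ 8
    k≢8 k≡8 = ℕₚ.<⇒≱ ℕₚ.≤-refl (subst (_≤ 7) k≡8 k≤7)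
  byDimension (inj₂ (inj₁ (k≡8 , origin≡12))) = ℕₚ.≤-reflexive k≡8 , (λ _ → length) , (λ n≡51 _ → projective n≡51)
    where
    length : (n ≡ 51) ⊎ (n ≡ 54) ⊎ (n ≡ 55) ⊎ (n ≡ 56)
    length = [ inj₁ ∘ proj₁ , inj₂ ∘ length≥54 n n≤56 ]′ (dimension8 k≡8 origin≡12)
    projective : n ≡ 51 → Projective G
    projective n≡51 = [ multiplicityFree⇒projective G col≢0 ∘ proj₂
                      , (λ 54≤n → contradiction (subst (54 ≤_) n≡51 54≤n) (ℕₚ.<⇒≱ (ℕₚ.≤ᵇ⇒≤ 52 54 _))) ]′
                      (dimension8 k≡8 origin≡12)
  byDimension (inj₂ (inj₂ (inj₁ (k≡9 , origin≡6)))) = ⊥-elim (dimension9 k≡9 origin≡6)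
  byDimension (inj₂ (inj₂ (inj₂ (_ , origin≡3))))   = ⊥-elim (dimension10 origin≡3)
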